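{- For every integer $m\ge 3$, $$\gamma_{\mathrm{sdR}}(P_{m,1})=\begin{cases} m & \text{if } m\equiv 0\pmod 2,\\ m+1 & \text{if } m\equiv 3\pmod 4,\\ m+2 & \text{if } m\equiv 1\pmod 4.\end{cases}$$
   Context: For $m\ge3$, $P_{m,1}$ (the $m$-prism) is the graph with vertex set $\{u_i,v_i:i\in\mathbb{Z}_m\}$ and edge set $\{u_iu_{i+1}, v_iv_{i+1}, u_iv_i: i\in\mathbb{Z}_m\}$. $N(u)$ is the open neighborhood, $N[u]=N(u)\cup\{u\}$; for $f:V\to\{ -1,1,2,3\}$, $V_i=f^{ -1}(i)$, $f(S)=\sum_{s\in S}f(s)$. A signed double Roman domination function (SDRDF) is $f:V\to\{ -1,1,2,3\}$ with: (1) every $u\in V_{ -1}$ has a neighbor in $V_3$ or at least two distinct neighbors in $V_2$; (2) every $u\in V_1$ has a neighbor in $V_2\cup V_3$; (3) $f(N[u])\ge1$ for all $u$. $\gamma_{\mathrm{sdR}}(G)$ is the minimum of $f(V)$ over all SDRDFs on $G$. -}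

module Defs where

open import Data.Nat as ℕ using (ℕ; zero; suc)
open import Data.Nat.Properties as ℕP using ()
open import Data.Integer as ℤ using (ℤ; +_; -[1+_]; _≤_)
open import Data.Bool using (Bool; true; false)
open import Data.Bool.Properties using () renaming (_≟_ to _≟ᵇ_)
open import Data.Fin using (Fin; toℕ)
open import Data.Fin.Properties using () renaming (_≟_ to _≟ᶠ_)
open import Data.Product using (Σ; ∃; ∃-syntax; _×_; _,_)
open import Data.Sum using (_⊎_)
open import Data.List using (List; []; _∷_; map; allFin; foldr; cartesianProduct)
open import Relation.Nullary using (¬_; Dec; yes; no; does)
open import Relation.Nullary.Decidable using (_×-dec_; _⊎-dec_)
open import Relation.Binary.PropositionalEquality using (_≡_; _≢_)

data Label : Set where
  m1 one two three : Label

val : Label → ℤ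
val m1    = -[1+ 0 ]
val one   = + 1
val two   = + 2
val three = + 3

CycSucc : (m : ℕ) → Fin m → Fin m → Set
CycSucc m i j = (toℕ j ≡ suc (toℕ i)) ⊎ ((suc (toℕ i) ≡ m) × (toℕ j ≡ 0))

cycSucc? : (m : ℕ) → (i j : Fin m) → Dec (CycSucc m i j)
cycSucc? m i j = (toℕ j ℕP.≟ suc (toℕ i)) ⊎-dec ((suc (toℕ i) ℕP.≟ m) ×-dec (toℕ j ℕP.≟ 0))

-- The prism P_{m,1}: vertex (false , i) is u_i, vertex (true , i) is v_i.
PVertex : ℕ → Set
PVertex m = Bool × Fin m

Adj : (m : ℕ) → PVertex m → PVertex m → Set
Adj m (b , i) (c , j) =
  ((b ≡ c) × (CycSucc m i j ⊎ CycSucc m j i)) ⊎ ((b ≢ c) × (i ≡ j))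

adj? : (m : ℕ) → (x y : PVertex m) → Dec (Adj m x y)
adj? m (b , i) (c , j) =
  ((b ≟ᵇ c) ×-dec (cycSucc? m i j ⊎-dec cycSucc? m j i))
  ⊎-dec ((Relation.Nullary.¬? (b ≟ᵇ c)) ×-dec (i ≟ᶠ j))
  where import Relation.Nullary

_≟ᵥ_ : {m : ℕ} → (x y : PVertex m) → Dec (x ≡ y)
_≟ᵥ_ {m} = Data.Product.Properties.≡-dec _≟ᵇ_ _≟ᶠ_
  where import Data.Product.Properties

allV : (m : ℕ) → List (PVertex m)
allV m = cartesianProduct (true ∷ false ∷ []) (allFin m)

sumℤ : List ℤ → ℤ
sumℤ = foldr ℤ._+_ (+ 0)

weight : (m : ℕ) → (PVertex m → Label) → ℤ
weight m f = sumℤ (map (λ w → val (f w)) (allV m))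

closedNbhdSum : (m : ℕ) → (PVertex m → Label) → PVertex m → ℤ
closedNbhdSum m f u = sumℤ (map term (allV m))
  where
  term : PVertex m → ℤ
  term w with does ((u ≟ᵥ w) ⊎-dec adj? m u w)
  ... | true  = val (f w)
  ... | false = + 0

record IsSDRDF (m : ℕ) (f : PVertex m → Label) : Set where
  field
    cond-1 : ∀ u → f u ≡ m1 →
      (∃[ w ] (Adj m u w × f w ≡ three)) ⊎
      (∃[ w ] ∃[ w' ] (w ≢ w' × Adj m u w × Adj m u w' × f w ≡ two × f w' ≡ two))
    cond1  : ∀ u → f u ≡ one →
      ∃[ w ] (Adj m u w × (f w ≡ two ⊎ f w ≡ three))
    cond3  : ∀ u → + 1 ≤ closedNbhdSum m f u

γsdR≡ : (m : ℕ) → ℤ → Set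
γsdR≡ m k =
  (∃[ f ] (IsSDRDF m f × weight m f ≡ k)) ×
  (∀ f → IsSDRDF m f → k ≤ weight m f)

-- Record a labelling column by column, x_i = (f(u_i), f(v_i)). Every condition of an SDRDF at
-- u_i or v_i only involves x_{i-1}, x_i and x_{i+1}, so f is an SDRDF exactly when every cyclic
-- window of three columns is valid, and f(V) is the sum of the column sums.
--
-- Lower bound: a computer-found potential ψ(r, x, y) on pairs of consecutive columns, indexed by a
-- phase r ∈ ℤ₄ and by one of ten classes chosen from the starting pair, satisfies
-- ψ(r + 1, y, z) + 1 ≤ colSum x + ψ(r, x, y) for every valid window (x, y, z). Telescoping once
-- around the cycle from phase 0 gives f(V) ≥ m + ψ(m mod 4, x₀, x₁) − ψ(0, x₀, x₁) ≥ m + excess.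
--
-- Upper bound: labellings made of a short prefix followed by a period-4 block of columns of total
-- weight 4, e.g. alternating columns (−1, −1) and (2, 2) when m is even.

module Submission where

open import Defs
open import Data.Nat using (ℕ; _≤_; _%_; _+_)
open import Data.Integer using (+_)
open import Data.Product using (_×_)
open import Relation.Binary.PropositionalEquality using (_≡_)

import Algebra.Properties.CommutativeMonoid.Sum as Sum
open import Data.Bool using (Bool; true; false; not; if_then_else_)
import Data.Bool.Properties as Bool
open import Data.Fin as Fin using (Fin; zero; suc; toℕ; fromℕ; fromℕ<; inject₁)
open import Data.Fin.Patterns using (0F; 1F; 2F; 3F; 4F; 5F; 6F; 7F; 8F; 9F)
import Data.Fin.Properties as Fin
open import Data.Integer as ℤ using (ℤ; _≤?_)
import Data.Integer.Properties as ℤ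
open import Data.Integer.Tactic.RingSolver using (solve-∀)
open import Data.List as List using (List; []; _∷_; _++_; tabulate)
import Data.List.Properties as List
open import Data.Nat as ℕ using (zero; suc; _*_; _<_; z≤n; s≤s)
open import Data.Nat.Divisibility using (divides)
open import Data.Nat.DivMod using (_/_; _divMod_; result; m%n<n; m<n⇒m%n≡m; n%n≡0; m≡m%n+[m/n]*n; m∣n⇒o%n%m≡o%m)
import Data.Nat.Properties as ℕ
open import Data.Product using (Σ; ∃-syntax; _,_; proj₁; proj₂)
open import Data.Sum using (_⊎_; inj₁; inj₂)
open import Data.Empty using (⊥-elim)
open import Data.Vec using (Vec; []; _∷_)
open import Function using (_∘_; id; _⇔_; mk⇔; module Equivalence)
open import Relation.Binary.Definitions using (DecidableEquality)
open import Relation.Binary.PropositionalEquality using (_≢_; refl; sym; trans; cong; cong₂; subst; subst₂; module ≡-Reasoning)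
open import Relation.Nullary using (Dec; yes; no; ¬_; does)
open import Relation.Nullary.Decidable using (_×-dec_; _⊎-dec_; _→-dec_; map′; from-yes; dec-true; dec-false)
open import Relation.Unary using (Decidable)

open Sum ℤ.+-0-commutativeMonoid using (sum-syntax; sum-cong-≗; sum-replicate-zero; ∑-distrib-+)

_≟ᴸ_ : DecidableEquality Label
m1    ≟ᴸ m1    = yes refl
m1    ≟ᴸ one   = no λ ()
m1    ≟ᴸ two   = no λ ()
m1    ≟ᴸ three = no λ ()
one   ≟ᴸ m1    = no λ ()
one   ≟ᴸ one   = yes refl
one   ≟ᴸ two   = no λ ()
one   ≟ᴸ three = no λ ()
two   ≟ᴸ m1    = no λ ()
two   ≟ᴸ one   = no λ ()
two   ≟ᴸ two   = yes refl
two   ≟ᴸ three = no λ ()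
three ≟ᴸ m1    = no λ ()
three ≟ᴸ one   = no λ ()
three ≟ᴸ two   = no λ ()
three ≟ᴸ three = yes refl

∀-Label? : {P : Label → Set} → Decidable P → Dec (∀ x → P x)
∀-Label? P? = map′ (λ { (p , q , r , s) → λ { m1 → p ; one → q ; two → r ; three → s } })
                   (λ h → h m1 , h one , h two , h three)
                   (P? m1 ×-dec P? one ×-dec P? two ×-dec P? three)

Column : Set
Column = Label × Label

colSum : Column → ℤ
colSum (a , b) = val a ℤ.+ val b

∀-Column? : {P : Column → Set} → Decidable P → Dec (∀ x → P x)
∀-Column? P? = map′ (λ h (a , b) → h a b) (λ h a b → h (a , b))
                    (∀-Label? λ a → ∀-Label? λ b → P? (a , b))

TwoOrThree : Label → Set
TwoOrThree x = x ≡ two ⊎ x ≡ three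

twoOrThree? : Decidable TwoOrThree
twoOrThree? x = (x ≟ᴸ two) ⊎-dec (x ≟ᴸ three)

MinusOneCondition : Label → Label → Label → Set
MinusOneCondition p q r =
  (p ≡ three ⊎ q ≡ three ⊎ r ≡ three) ⊎
  (p ≡ two × q ≡ two ⊎ p ≡ two × r ≡ two ⊎ q ≡ two × r ≡ two)

OneCondition : Label → Label → Label → Set
OneCondition p q r = TwoOrThree p ⊎ TwoOrThree q ⊎ TwoOrThree r

LocalCondition : Label → Label → Label → Label → Set
LocalCondition a p q r =
  (a ≡ m1 → MinusOneCondition p q r) × (a ≡ one → OneCondition p q r) ×
  + 1 ℤ.≤ val a ℤ.+ (val p ℤ.+ (val q ℤ.+ val r))

localCondition? : ∀ a p q r → Dec (LocalCondition a p q r)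
localCondition? a p q r =
  (a ≟ᴸ m1 →-dec minusOneCondition?) ×-dec (a ≟ᴸ one →-dec oneCondition?) ×-dec
  (+ 1 ≤? val a ℤ.+ (val p ℤ.+ (val q ℤ.+ val r)))
  where
  minusOneCondition? : Dec (MinusOneCondition p q r)
  minusOneCondition? =
    (p ≟ᴸ three ⊎-dec q ≟ᴸ three ⊎-dec r ≟ᴸ three) ⊎-dec
    (p ≟ᴸ two ×-dec q ≟ᴸ two ⊎-dec p ≟ᴸ two ×-dec r ≟ᴸ two ⊎-dec q ≟ᴸ two ×-dec r ≟ᴸ two)
  oneCondition? : Dec (OneCondition p q r)
  oneCondition? = twoOrThree? p ⊎-dec twoOrThree? q ⊎-dec twoOrThree? r

-- A column is (label of u_i , label of v_i); ValidTriple x y z says that both vertices of the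
-- middle column y satisfy the local conditions when x and z are the neighbouring columns.
ValidTriple : Column → Column → Column → Set
ValidTriple (a , b) (c , d) (e , f) = LocalCondition c a e d × LocalCondition d b f c

validTriple? : ∀ x y z → Dec (ValidTriple x y z)
validTriple? (a , b) (c , d) (e , f) = localCondition? c a e d ×-dec localCondition? d b f c

Window : (ℕ → Column) → ℕ → Set
Window g k = ValidTriple (g k) (g (suc k)) (g (suc (suc k)))

sumℤ-++ : ∀ xs ys → sumℤ (xs ++ ys) ≡ sumℤ xs ℤ.+ sumℤ ys
sumℤ-++ []       ys = sym (ℤ.+-identityˡ _)
sumℤ-++ (x ∷ xs) ys = trans (cong (ℤ._+_ x) (sumℤ-++ xs ys)) (sym (ℤ.+-assoc x _ _))

sumℤ-tabulate : ∀ {k} (h : Fin k → ℤ) → sumℤ (tabulate h) ≡ ∑[ j < k ] h j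
sumℤ-tabulate {zero}  h = refl
sumℤ-tabulate {suc k} h = cong (ℤ._+_ (h zero)) (sumℤ-tabulate (h ∘ suc))

δ : ∀ {k} → Fin k → ℤ → Fin k → ℤ
δ a x j = if does (j Fin.≟ a) then x else + 0

δ-self : ∀ {k} (a : Fin k) x → δ a x a ≡ x
δ-self a x rewrite dec-true (a Fin.≟ a) refl = refl

δ-≢ : ∀ {k} {a j : Fin k} x → j ≢ a → δ a x j ≡ + 0
δ-≢ {a = a} {j} x j≢a rewrite dec-false (j Fin.≟ a) j≢a = refl

∑-δ : ∀ {k} (a : Fin k) x → ∑[ j < k ] δ a x j ≡ x
∑-δ {suc k} zero    x = trans (cong (ℤ._+_ x) (sum-replicate-zero k)) (ℤ.+-identityʳ x)
∑-δ {suc k} (suc a) x = trans (ℤ.+-identityˡ _) (∑-δ a x)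

∑-split : ∀ a b (g : ℕ → ℤ) →
  ∑[ k < a + b ] g (toℕ k) ≡ ∑[ k < a ] g (toℕ k) ℤ.+ ∑[ k < b ] g (a + toℕ k)
∑-split zero    b g = sym (ℤ.+-identityˡ _)
∑-split (suc a) b g = trans (cong (ℤ._+_ (g 0)) (∑-split a b (g ∘ suc))) (sym (ℤ.+-assoc (g 0) _ _))

-- Defs enumerates the vertices row by row: first all v_i, then all u_i.
sumℤ-allV : ∀ m (g : PVertex m → ℤ) →
  sumℤ (List.map g (allV m)) ≡ ∑[ j < m ] g (true , j) ℤ.+ (∑[ j < m ] g (false , j) ℤ.+ + 0)
sumℤ-allV m g = begin
  sumℤ (List.map g (row true ++ (row false ++ [])))
    ≡⟨ cong sumℤ (List.map-++ g (row true) _) ⟩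
  sumℤ (List.map g (row true) ++ List.map g (row false ++ []))
    ≡⟨ sumℤ-++ (List.map g (row true)) _ ⟩
  sumℤ (List.map g (row true)) ℤ.+ sumℤ (List.map g (row false ++ []))
    ≡⟨ cong₂ ℤ._+_ (rowSum true) (trans (cong sumℤ (List.map-++ g (row false) [])) (trans (sumℤ-++ (List.map g (row false)) []) (cong (λ y → y ℤ.+ + 0) (rowSum false)))) ⟩
  ∑[ j < m ] g (true , j) ℤ.+ (∑[ j < m ] g (false , j) ℤ.+ + 0) ∎
  where
  open ≡-Reasoning
  row : Bool → List (PVertex m)
  row b = List.map (b ,_) (List.allFin m)
  rowSum : ∀ b → sumℤ (List.map g (row b)) ≡ ∑[ j < m ] g (b , j)
  rowSum b = trans (cong sumℤ (trans (cong (List.map g) (List.map-tabulate id (b ,_))) (List.map-tabulate (b ,_) g)))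
                   (sumℤ-tabulate (λ j → g (b , j)))

-- The summand of closedNbhdSum is local to a where block in Defs; this names it.
summand : ∀ m f u → Σ (PVertex m → ℤ) λ g → closedNbhdSum m f u ≡ sumℤ (List.map g (allV m))
summand m f u = _ , refl

summand-in : ∀ m f u w → u ≡ w ⊎ Adj m u w → proj₁ (summand m f u) w ≡ val (f w)
summand-in m f u w w∈N[u] with does ((u ≟ᵥ w) ⊎-dec adj? m u w) | dec-true ((u ≟ᵥ w) ⊎-dec adj? m u w) w∈N[u]
... | true  | _  = refl
... | false | ()

summand-out : ∀ m f u w → ¬ (u ≡ w ⊎ Adj m u w) → proj₁ (summand m f u) w ≡ + 0
summand-out m f u w w∉N[u] with does ((u ≟ᵥ w) ⊎-dec adj? m u w) | dec-false ((u ≟ᵥ w) ⊎-dec adj? m u w) w∉N[u]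
... | false | _  = refl
... | true  | ()

+-cancelʳ-≤ : ∀ a b c → a ℤ.+ c ℤ.≤ b ℤ.+ c → a ℤ.≤ b
+-cancelʳ-≤ a b c a+c≤b+c = begin
  a                       ≡⟨ cancel a c ⟨
  a ℤ.+ c ℤ.+ ℤ.- c       ≤⟨ ℤ.+-monoˡ-≤ (ℤ.- c) a+c≤b+c ⟩
  b ℤ.+ c ℤ.+ ℤ.- c       ≡⟨ cancel b c ⟩
  b                       ∎
  where
  open ℤ.≤-Reasoning
  cancel : ∀ x y → x ℤ.+ y ℤ.+ ℤ.- y ≡ x
  cancel = solve-∀

-- Phases modulo 4 and the telescoping argument

data ℤ₄ : Set where
  0₄ 1₄ 2₄ 3₄ : ℤ₄

suc₄ : ℤ₄ → ℤ₄
suc₄ 0₄ = 1₄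
suc₄ 1₄ = 2₄
suc₄ 2₄ = 3₄
suc₄ 3₄ = 0₄

infixl 6 _+₄_

_+₄_ : ℤ₄ → ℕ → ℤ₄
r +₄ zero  = r
r +₄ suc k = suc₄ r +₄ k

+₄-suc : ∀ r k → r +₄ suc k ≡ suc₄ (r +₄ k)
+₄-suc r zero    = refl
+₄-suc r (suc k) = +₄-suc (suc₄ r) k

+₄-+ : ∀ r a b → r +₄ (a + b) ≡ r +₄ a +₄ b
+₄-+ r zero    b = refl
+₄-+ r (suc a) b = +₄-+ (suc₄ r) a b

+₄-*4 : ∀ r q → r +₄ q * 4 ≡ r
+₄-*4 r  zero    = refl
+₄-*4 0₄ (suc q) = +₄-*4 0₄ q
+₄-*4 1₄ (suc q) = +₄-*4 1₄ q
+₄-*4 2₄ (suc q) = +₄-*4 2₄ q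
+₄-*4 3₄ (suc q) = +₄-*4 3₄ q

+₄-%4 : ∀ r k → r +₄ k ≡ r +₄ k % 4
+₄-%4 r k = begin
  r +₄ k                     ≡⟨ cong (r +₄_) (m≡m%n+[m/n]*n k 4) ⟩
  r +₄ (k % 4 + k / 4 * 4)   ≡⟨ +₄-+ r (k % 4) (k / 4 * 4) ⟩
  r +₄ k % 4 +₄ k / 4 * 4    ≡⟨ +₄-*4 (r +₄ k % 4) (k / 4) ⟩
  r +₄ k % 4                 ∎
  where open ≡-Reasoning

∀-ℤ₄? : {P : ℤ₄ → Set} → Decidable P → Dec (∀ r → P r)
∀-ℤ₄? P? = map′ (λ { (p , q , r , s) → λ { 0₄ → p ; 1₄ → q ; 2₄ → r ; 3₄ → s } })
                (λ h → h 0₄ , h 1₄ , h 2₄ , h 3₄)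
                (P? 0₄ ×-dec P? 1₄ ×-dec P? 2₄ ×-dec P? 3₄)

module Telescoping {C : Set} (Valid : C → C → C → Set) (cost : C → ℤ) (ψ : ℤ₄ → C → C → ℤ)
  (decreasing : ∀ {x y z} → Valid x y z → ∀ r → ψ (suc₄ r) y z ℤ.+ + 1 ℤ.≤ cost x ℤ.+ ψ r x y) where

  telescope : ∀ k (t : ℕ → C) r → (∀ j → Valid (t j) (t (suc j)) (t (suc (suc j)))) →
    ψ (r +₄ k) (t k) (t (suc k)) ℤ.+ + k ℤ.≤ ∑[ j < k ] cost (t (toℕ j)) ℤ.+ ψ r (t 0) (t 1)
  telescope zero    t r valid = ℤ.≤-reflexive (trans (ℤ.+-identityʳ (ψ r (t 0) (t 1))) (sym (ℤ.+-identityˡ _)))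
  telescope (suc k) t r valid = begin
    ψ′ (t (suc k)) (t (2 + k)) ℤ.+ (+ 1 ℤ.+ + k)  ≡⟨ swap-last (ψ′ (t (suc k)) (t (2 + k))) (+ k) (+ 1) ⟩
    ψ′ (t (suc k)) (t (2 + k)) ℤ.+ + k ℤ.+ + 1    ≤⟨ ℤ.+-monoˡ-≤ (+ 1) (telescope k (t ∘ suc) (suc₄ r) (valid ∘ suc)) ⟩
    rest ℤ.+ ψ (suc₄ r) (t 1) (t 2) ℤ.+ + 1       ≡⟨ ℤ.+-assoc rest _ _ ⟩
    rest ℤ.+ (ψ (suc₄ r) (t 1) (t 2) ℤ.+ + 1)     ≤⟨ ℤ.+-monoʳ-≤ rest (decreasing (valid 0) r) ⟩
    rest ℤ.+ (cost (t 0) ℤ.+ ψ r (t 0) (t 1))     ≡⟨ swap-first rest (cost (t 0)) (ψ r (t 0) (t 1)) ⟩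
    cost (t 0) ℤ.+ rest ℤ.+ ψ r (t 0) (t 1)       ∎
    where
    open ℤ.≤-Reasoning
    ψ′ : C → C → ℤ
    ψ′ = ψ (suc₄ r +₄ k)
    rest : ℤ
    rest = ∑[ j < k ] cost (t (suc (toℕ j)))
    swap-last : ∀ x y z → x ℤ.+ (z ℤ.+ y) ≡ x ℤ.+ y ℤ.+ z
    swap-last = solve-∀
    swap-first : ∀ x y z → x ℤ.+ (y ℤ.+ z) ≡ y ℤ.+ x ℤ.+ z
    swap-first = solve-∀

-- The potential certificate

-- Found by a baseWeight-path computation in the digraph of valid windows lifted to phases ℤ₄;
-- only potential-decreasing and potential-endpoint below are used.

data Quad (A : Set) : Set where
  quad : A → A → A → A → Quad A

infixl 20 _!ᴸ_ _!₄_

_!ᴸ_ : {A : Set} → Quad A → Label → A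
quad a b c d !ᴸ m1    = a
quad a b c d !ᴸ one   = b
quad a b c d !ᴸ two   = c
quad a b c d !ᴸ three = d

_!₄_ : {A : Set} → Quad A → ℤ₄ → A
quad a b c d !₄ 0₄ = a
quad a b c d !₄ 1₄ = b
quad a b c d !₄ 2₄ = c
quad a b c d !₄ 3₄ = d

excess : ℤ₄ → ℕ
excess 0₄ = 0
excess 1₄ = 2
excess 2₄ = 0
excess 3₄ = 1

Class : Set
Class = Fin 10

potentialTable : Class → Quad (Quad (Quad (Quad (Quad ℕ))))
potentialTable 0F = quad
  (quad (quad (quad (quad 0 2 0 1) (quad 8 10 10 10) (quad 8 10 10 10) (quad 8 10 10 10)) (quad (quad 8 10 10 10) (quad 7 9 7 9) (quad 6 8 7 8) (quad 6 8 7 7)) (quad (quad 8 10 10 10) (quad 7 8 6 8) (quad 6 7 6 7) (quad 5 7 6 7)) (quad (quad 8 10 10 10) (quad 7 7 6 8) (quad 6 7 5 7) (quad 5 7 5 7)))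
        (quad (quad (quad 6 8 7 8) (quad 6 8 7 8) (quad 6 6 7 6) (quad 6 6 7 6)) (quad (quad 6 8 7 8) (quad 6 8 7 8) (quad 4 6 7 6) (quad 4 6 7 6)) (quad (quad 6 7 6 7) (quad 5 7 6 7) (quad 4 6 6 5) (quad 4 6 6 5)) (quad (quad 5 5 5 6) (quad 5 5 5 6) (quad 5 5 5 5) (quad 3 5 5 5)))
        (quad (quad (quad 5 7 6 7) (quad 5 5 6 5) (quad 5 5 6 5) (quad 5 5 6 5)) (quad (quad 5 7 6 7) (quad 5 5 6 5) (quad 3 5 6 5) (quad 3 5 6 5)) (quad (quad 5 5 5 6) (quad 5 5 5 5) (quad 3 5 5 5) (quad 3 5 5 5)) (quad (quad 5 5 5 6) (quad 5 5 5 5) (quad 3 5 5 5) (quad 3 5 5 5)))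
        (quad (quad (quad 3 5 5 6) (quad 4 4 5 4) (quad 4 4 5 4) (quad 4 4 5 4)) (quad (quad 5 5 5 6) (quad 4 4 5 4) (quad 2 4 5 4) (quad 2 4 5 4)) (quad (quad 5 5 5 6) (quad 4 4 5 4) (quad 2 4 5 4) (quad 2 4 5 4)) (quad (quad 3 5 5 6) (quad 4 4 5 4) (quad 2 4 5 4) (quad 2 4 5 4))))
  (quad (quad (quad (quad 6 8 6 8) (quad 6 8 6 8) (quad 6 7 6 7) (quad 5 6 5 5)) (quad (quad 6 8 6 8) (quad 6 8 6 8) (quad 5 7 6 7) (quad 4 6 5 5)) (quad (quad 7 6 6 6) (quad 7 6 6 6) (quad 6 5 5 6) (quad 3 5 5 5)) (quad (quad 7 6 6 6) (quad 7 6 6 6) (quad 6 5 5 6) (quad 3 5 5 5)))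
        (quad (quad (quad 6 7 6 7) (quad 5 7 6 7) (quad 4 6 5 5) (quad 4 6 5 5)) (quad (quad 5 7 6 7) (quad 5 7 6 7) (quad 4 6 5 5) (quad 4 6 5 5)) (quad (quad 5 5 5 6) (quad 3 5 5 6) (quad 2 4 5 4) (quad 2 4 5 4)) (quad (quad 5 5 5 6) (quad 3 5 5 6) (quad 2 4 5 4) (quad 2 4 5 4)))
        (quad (quad (quad 5 3 5 4) (quad 5 3 5 4) (quad 5 3 5 4) (quad 5 3 5 4)) (quad (quad 5 3 5 4) (quad 5 3 5 4) (quad 1 3 5 4) (quad 1 3 5 4)) (quad (quad 5 3 5 4) (quad 5 3 5 4) (quad 1 3 5 4) (quad 1 3 5 4)) (quad (quad 5 3 5 4) (quad 5 3 5 4) (quad 1 3 5 4) (quad 1 3 5 4)))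
        (quad (quad (quad 4 3 5 4) (quad 4 3 5 4) (quad 4 3 5 4) (quad 4 3 5 4)) (quad (quad 4 3 5 4) (quad 4 3 5 4) (quad 1 3 5 4) (quad 1 3 5 4)) (quad (quad 4 3 5 4) (quad 1 3 5 4) (quad 1 3 5 4) (quad 1 3 5 4)) (quad (quad 4 3 5 4) (quad 1 3 5 4) (quad 1 3 5 4) (quad 1 3 5 4))))
  (quad (quad (quad (quad 5 7 5 7) (quad 6 7 5 7) (quad 5 6 5 5) (quad 4 6 5 5)) (quad (quad 6 5 5 5) (quad 6 5 5 5) (quad 3 5 5 5) (quad 3 5 5 5)) (quad (quad 6 5 5 5) (quad 6 5 5 5) (quad 3 5 5 5) (quad 3 5 5 5)) (quad (quad 6 5 5 5) (quad 6 5 5 5) (quad 3 5 5 5) (quad 3 5 5 5)))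
        (quad (quad (quad 5 4 5 3) (quad 5 4 5 3) (quad 5 4 5 3) (quad 5 4 5 3)) (quad (quad 5 4 5 3) (quad 5 4 5 3) (quad 2 4 5 3) (quad 2 4 5 3)) (quad (quad 5 4 5 3) (quad 2 4 5 3) (quad 2 4 5 3) (quad 2 4 5 3)) (quad (quad 5 4 5 3) (quad 2 4 5 3) (quad 2 4 5 3) (quad 2 4 5 3)))
        (quad (quad (quad 4 3 4 3) (quad 4 3 4 3) (quad 4 3 4 3) (quad 4 3 4 3)) (quad (quad 4 3 4 3) (quad 4 3 4 3) (quad 1 3 4 3) (quad 1 3 4 3)) (quad (quad 4 3 4 3) (quad 1 3 4 3) (quad 1 3 4 3) (quad 1 3 4 3)) (quad (quad 4 3 4 3) (quad 1 3 4 3) (quad 1 3 4 3) (quad 1 3 4 3)))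
        (quad (quad (quad 4 2 4 3) (quad 4 2 4 3) (quad 4 2 4 3) (quad 4 2 4 3)) (quad (quad 4 2 4 3) (quad 4 2 4 3) (quad 0 2 4 3) (quad 0 2 4 3)) (quad (quad 4 2 4 3) (quad 0 2 4 3) (quad 0 2 4 3) (quad 0 2 4 3)) (quad (quad 4 2 4 3) (quad 0 2 4 3) (quad 0 2 4 3) (quad 0 2 4 3))))
  (quad (quad (quad (quad 4 6 5 6) (quad 5 6 5 5) (quad 4 6 5 5) (quad 4 6 5 5)) (quad (quad 5 4 4 4) (quad 5 4 4 4) (quad 2 4 4 4) (quad 2 4 4 4)) (quad (quad 5 4 4 4) (quad 5 4 4 4) (quad 2 4 4 4) (quad 2 4 4 4)) (quad (quad 5 4 4 4) (quad 5 4 4 4) (quad 2 4 4 4) (quad 2 4 4 4)))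
        (quad (quad (quad 5 4 4 3) (quad 5 4 4 3) (quad 5 4 4 3) (quad 2 4 4 3)) (quad (quad 5 4 4 3) (quad 5 4 4 3) (quad 2 4 4 3) (quad 2 4 4 3)) (quad (quad 5 4 4 3) (quad 2 4 4 3) (quad 2 4 4 3) (quad 2 4 4 3)) (quad (quad 5 4 4 3) (quad 2 4 4 3) (quad 2 4 4 3) (quad 2 4 4 3)))
        (quad (quad (quad 4 3 4 2) (quad 4 3 4 2) (quad 4 3 4 2) (quad 1 3 4 2)) (quad (quad 4 3 4 2) (quad 4 3 4 2) (quad 1 3 4 2) (quad 1 3 4 2)) (quad (quad 4 3 4 2) (quad 1 3 4 2) (quad 1 3 4 2) (quad 1 3 4 2)) (quad (quad 4 3 4 2) (quad 1 3 4 2) (quad 1 3 4 2) (quad 1 3 4 2)))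
        (quad (quad (quad 4 2 4 2) (quad 4 2 4 2) (quad 4 2 4 2) (quad 0 2 4 2)) (quad (quad 4 2 4 2) (quad 4 2 4 2) (quad 0 2 4 2) (quad 0 2 4 2)) (quad (quad 4 2 4 2) (quad 0 2 4 2) (quad 0 2 4 2) (quad 0 2 4 2)) (quad (quad 4 2 4 2) (quad 0 2 4 2) (quad 0 2 4 2) (quad 0 2 4 2))))
potentialTable 1F = quad
  (quad (quad (quad (quad 0 2 0 1) (quad 8 8 8 8) (quad 8 8 8 8) (quad 8 8 8 8)) (quad (quad 8 8 8 8) (quad 7 8 7 8) (quad 7 7 6 8) (quad 7 7 6 8)) (quad (quad 8 8 8 8) (quad 6 8 7 8) (quad 6 7 6 7) (quad 6 7 5 7)) (quad (quad 8 8 8 8) (quad 6 8 7 7) (quad 5 7 6 6) (quad 5 6 5 6)))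
        (quad (quad (quad 7 7 6 8) (quad 7 7 6 8) (quad 7 6 6 6) (quad 7 6 6 6)) (quad (quad 7 7 6 8) (quad 7 7 6 8) (quad 7 6 6 6) (quad 7 6 6 6)) (quad (quad 5 7 6 7) (quad 6 7 6 7) (quad 6 5 5 6) (quad 6 5 5 6)) (quad (quad 5 6 5 5) (quad 4 6 5 5) (quad 3 5 5 5) (quad 5 5 5 5)))
        (quad (quad (quad 6 7 5 7) (quad 6 5 5 5) (quad 6 5 5 5) (quad 6 5 5 5)) (quad (quad 6 7 5 7) (quad 6 5 5 5) (quad 6 5 5 5) (quad 6 5 5 5)) (quad (quad 5 6 5 5) (quad 3 5 5 5) (quad 5 5 5 5) (quad 5 5 5 5)) (quad (quad 4 6 5 5) (quad 3 5 5 5) (quad 5 5 5 5) (quad 5 5 5 5)))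
        (quad (quad (quad 5 6 5 6) (quad 5 4 4 4) (quad 5 4 4 4) (quad 5 4 4 4)) (quad (quad 5 6 5 5) (quad 5 4 4 4) (quad 5 4 4 4) (quad 5 4 4 4)) (quad (quad 4 6 5 5) (quad 2 4 4 4) (quad 5 4 4 4) (quad 5 4 4 4)) (quad (quad 5 6 5 5) (quad 2 4 4 4) (quad 5 4 4 4) (quad 5 4 4 4))))
  (quad (quad (quad (quad 6 8 7 8) (quad 6 8 7 8) (quad 6 7 6 7) (quad 5 5 5 6)) (quad (quad 6 8 7 8) (quad 6 8 7 8) (quad 6 7 6 7) (quad 5 5 5 6)) (quad (quad 6 6 7 6) (quad 4 6 7 6) (quad 4 6 6 5) (quad 5 5 5 5)) (quad (quad 6 6 7 6) (quad 4 6 7 6) (quad 4 6 6 5) (quad 5 5 5 5)))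
        (quad (quad (quad 5 7 6 7) (quad 6 7 6 7) (quad 5 4 5 6) (quad 5 4 5 6)) (quad (quad 6 7 6 7) (quad 6 7 6 7) (quad 5 4 5 6) (quad 5 4 5 6)) (quad (quad 4 6 5 5) (quad 5 6 5 5) (quad 5 4 5 4) (quad 5 4 5 4)) (quad (quad 4 6 5 5) (quad 5 6 5 5) (quad 5 4 5 4) (quad 5 4 5 4)))
        (quad (quad (quad 5 4 4 3) (quad 5 4 4 3) (quad 5 4 4 3) (quad 5 4 4 3)) (quad (quad 5 4 4 3) (quad 5 4 4 3) (quad 5 4 4 3) (quad 5 4 4 3)) (quad (quad 5 4 4 3) (quad 2 4 4 3) (quad 5 4 4 3) (quad 5 4 4 3)) (quad (quad 5 4 4 3) (quad 2 4 4 3) (quad 5 4 4 3) (quad 5 4 4 3)))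
        (quad (quad (quad 5 4 4 3) (quad 5 4 4 3) (quad 5 4 4 3) (quad 5 4 4 3)) (quad (quad 5 4 4 3) (quad 5 4 4 3) (quad 5 4 4 3) (quad 5 4 4 3)) (quad (quad 2 4 4 3) (quad 5 4 4 3) (quad 5 4 4 3) (quad 5 4 4 3)) (quad (quad 2 4 4 3) (quad 5 4 4 3) (quad 5 4 4 3) (quad 5 4 4 3))))
  (quad (quad (quad (quad 5 5 6 6) (quad 5 5 6 6) (quad 5 5 5 6) (quad 5 5 5 6)) (quad (quad 5 5 6 5) (quad 5 5 6 5) (quad 5 4 5 5) (quad 5 4 5 5)) (quad (quad 5 5 6 5) (quad 3 5 6 5) (quad 5 4 5 5) (quad 5 4 5 5)) (quad (quad 5 5 6 5) (quad 3 5 6 5) (quad 5 4 5 5) (quad 5 4 5 5)))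
        (quad (quad (quad 5 3 5 4) (quad 5 3 5 4) (quad 5 3 5 4) (quad 5 3 5 4)) (quad (quad 5 3 5 4) (quad 5 3 5 4) (quad 5 3 5 4) (quad 5 3 5 4)) (quad (quad 5 3 5 4) (quad 5 3 5 4) (quad 5 3 5 4) (quad 5 3 5 4)) (quad (quad 5 3 5 4) (quad 5 3 5 4) (quad 5 3 5 4) (quad 5 3 5 4)))
        (quad (quad (quad 4 3 4 3) (quad 4 3 4 3) (quad 4 3 4 3) (quad 4 3 4 3)) (quad (quad 4 3 4 3) (quad 4 3 4 3) (quad 4 3 4 3) (quad 4 3 4 3)) (quad (quad 4 3 4 3) (quad 4 3 4 3) (quad 4 3 4 3) (quad 4 3 4 3)) (quad (quad 4 3 4 3) (quad 4 3 4 3) (quad 4 3 4 3) (quad 4 3 4 3)))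
        (quad (quad (quad 4 3 4 2) (quad 4 3 4 2) (quad 4 3 4 2) (quad 4 3 4 2)) (quad (quad 4 3 4 2) (quad 4 3 4 2) (quad 4 3 4 2) (quad 4 3 4 2)) (quad (quad 1 3 4 2) (quad 4 3 4 2) (quad 4 3 4 2) (quad 4 3 4 2)) (quad (quad 1 3 4 2) (quad 4 3 4 2) (quad 4 3 4 2) (quad 4 3 4 2))))
  (quad (quad (quad (quad 5 5 5 6) (quad 5 5 5 6) (quad 5 5 5 6) (quad 5 5 5 6)) (quad (quad 4 4 5 4) (quad 4 4 5 4) (quad 4 4 5 4) (quad 4 4 5 4)) (quad (quad 4 4 5 4) (quad 2 4 5 4) (quad 4 4 5 4) (quad 4 4 5 4)) (quad (quad 4 4 5 4) (quad 2 4 5 4) (quad 4 4 5 4) (quad 4 4 5 4)))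
        (quad (quad (quad 4 3 5 4) (quad 4 3 5 4) (quad 4 3 5 4) (quad 4 3 5 4)) (quad (quad 4 3 5 4) (quad 1 3 5 4) (quad 4 3 5 4) (quad 4 3 5 4)) (quad (quad 4 3 5 4) (quad 4 3 5 4) (quad 4 3 5 4) (quad 4 3 5 4)) (quad (quad 4 3 5 4) (quad 4 3 5 4) (quad 4 3 5 4) (quad 4 3 5 4)))
        (quad (quad (quad 3 2 4 3) (quad 3 2 4 3) (quad 3 2 4 3) (quad 3 2 4 3)) (quad (quad 3 2 4 3) (quad 3 2 4 3) (quad 3 2 4 3) (quad 3 2 4 3)) (quad (quad 3 2 4 3) (quad 3 2 4 3) (quad 3 2 4 3) (quad 3 2 4 3)) (quad (quad 3 2 4 3) (quad 3 2 4 3) (quad 3 2 4 3) (quad 3 2 4 3)))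
        (quad (quad (quad 3 2 3 2) (quad 3 2 3 2) (quad 3 2 3 2) (quad 3 2 3 2)) (quad (quad 3 2 3 2) (quad 3 2 3 2) (quad 3 2 3 2) (quad 3 2 3 2)) (quad (quad 0 2 3 2) (quad 3 2 3 2) (quad 3 2 3 2) (quad 3 2 3 2)) (quad (quad 0 2 3 2) (quad 3 2 3 2) (quad 3 2 3 2) (quad 3 2 3 2))))
potentialTable 2F = quad
  (quad (quad (quad (quad 0 2 0 1) (quad 7 7 7 7) (quad 7 7 7 7) (quad 7 7 7 7)) (quad (quad 7 7 7 7) (quad 7 7 7 7) (quad 6 7 6 7) (quad 6 6 6 6)) (quad (quad 7 7 7 7) (quad 6 7 6 7) (quad 5 7 5 7) (quad 5 6 5 6)) (quad (quad 7 7 7 7) (quad 6 6 6 6) (quad 5 6 5 6) (quad 5 6 5 6)))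
        (quad (quad (quad 6 7 6 7) (quad 6 7 6 7) (quad 5 6 5 5) (quad 5 6 5 5)) (quad (quad 6 7 6 7) (quad 6 7 6 7) (quad 5 6 5 5) (quad 5 6 5 5)) (quad (quad 5 7 5 7) (quad 5 7 5 7) (quad 5 5 4 5) (quad 5 5 4 5)) (quad (quad 4 4 5 4) (quad 4 4 5 4) (quad 4 4 4 4) (quad 4 4 4 4)))
        (quad (quad (quad 5 5 5 6) (quad 4 5 4 4) (quad 4 5 4 4) (quad 4 5 4 4)) (quad (quad 5 5 5 6) (quad 3 5 4 4) (quad 4 5 4 4) (quad 4 5 4 4)) (quad (quad 4 4 5 4) (quad 4 4 4 4) (quad 4 4 4 4) (quad 4 4 4 4)) (quad (quad 4 4 5 4) (quad 4 4 4 4) (quad 4 4 4 4) (quad 4 4 4 4)))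
        (quad (quad (quad 5 4 5 5) (quad 3 4 3 3) (quad 3 4 3 3) (quad 3 4 3 3)) (quad (quad 4 4 5 4) (quad 2 4 3 3) (quad 3 4 3 3) (quad 3 4 3 3)) (quad (quad 4 4 5 4) (quad 3 4 3 3) (quad 3 4 3 3) (quad 3 4 3 3)) (quad (quad 4 4 5 4) (quad 3 4 3 3) (quad 3 4 3 3) (quad 3 4 3 3))))
  (quad (quad (quad (quad 6 7 6 7) (quad 6 7 6 7) (quad 5 7 5 7) (quad 5 4 4 4)) (quad (quad 6 7 6 7) (quad 6 7 6 7) (quad 5 7 5 7) (quad 5 4 4 4)) (quad (quad 5 5 5 6) (quad 5 5 5 6) (quad 5 5 5 5) (quad 4 4 4 4)) (quad (quad 5 5 5 6) (quad 5 5 5 6) (quad 5 5 5 5) (quad 4 4 4 4)))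
        (quad (quad (quad 5 4 5 7) (quad 5 4 5 7) (quad 5 4 4 4) (quad 5 4 4 4)) (quad (quad 5 4 5 7) (quad 5 4 5 7) (quad 5 4 4 4) (quad 5 4 4 4)) (quad (quad 4 3 5 4) (quad 4 3 5 4) (quad 4 3 4 4) (quad 4 3 4 4)) (quad (quad 4 3 5 4) (quad 4 3 5 4) (quad 4 3 4 4) (quad 4 3 4 4)))
        (quad (quad (quad 4 3 4 3) (quad 4 3 4 3) (quad 4 3 4 3) (quad 4 3 4 3)) (quad (quad 4 3 4 3) (quad 1 3 4 3) (quad 4 3 4 3) (quad 4 3 4 3)) (quad (quad 4 3 4 3) (quad 4 3 4 3) (quad 4 3 4 3) (quad 4 3 4 3)) (quad (quad 4 3 4 3) (quad 4 3 4 3) (quad 4 3 4 3) (quad 4 3 4 3)))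
        (quad (quad (quad 3 3 3 3) (quad 1 3 3 3) (quad 1 3 3 3) (quad 1 3 3 3)) (quad (quad 3 3 3 3) (quad 1 3 3 3) (quad 3 3 3 3) (quad 3 3 3 3)) (quad (quad 3 3 3 3) (quad 3 3 3 3) (quad 3 3 3 3) (quad 3 3 3 3)) (quad (quad 3 3 3 3) (quad 3 3 3 3) (quad 3 3 3 3) (quad 3 3 3 3))))
  (quad (quad (quad (quad 5 4 5 6) (quad 5 4 5 6) (quad 5 4 4 4) (quad 5 4 4 4)) (quad (quad 4 4 4 5) (quad 4 4 4 5) (quad 4 4 4 4) (quad 4 4 4 4)) (quad (quad 4 4 4 5) (quad 4 4 4 5) (quad 4 4 4 4) (quad 4 4 4 4)) (quad (quad 4 4 4 5) (quad 4 4 4 5) (quad 4 4 4 4) (quad 4 4 4 4)))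
        (quad (quad (quad 4 3 4 3) (quad 4 3 4 3) (quad 4 3 4 3) (quad 4 3 4 3)) (quad (quad 4 3 4 3) (quad 4 3 4 3) (quad 4 3 4 3) (quad 4 3 4 3)) (quad (quad 4 3 4 3) (quad 4 3 4 3) (quad 4 3 4 3) (quad 4 3 4 3)) (quad (quad 4 3 4 3) (quad 4 3 4 3) (quad 4 3 4 3) (quad 4 3 4 3)))
        (quad (quad (quad 4 2 4 2) (quad 4 2 4 2) (quad 4 2 4 2) (quad 4 2 4 2)) (quad (quad 4 2 4 2) (quad 4 2 4 2) (quad 4 2 4 2) (quad 4 2 4 2)) (quad (quad 4 2 4 2) (quad 4 2 4 2) (quad 4 2 4 2) (quad 4 2 4 2)) (quad (quad 4 2 4 2) (quad 4 2 4 2) (quad 4 2 4 2) (quad 4 2 4 2)))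
        (quad (quad (quad 3 2 3 2) (quad 3 2 3 2) (quad 3 2 3 2) (quad 0 2 3 2)) (quad (quad 3 2 3 2) (quad 0 2 3 2) (quad 3 2 3 2) (quad 3 2 3 2)) (quad (quad 3 2 3 2) (quad 3 2 3 2) (quad 3 2 3 2) (quad 3 2 3 2)) (quad (quad 3 2 3 2) (quad 3 2 3 2) (quad 3 2 3 2) (quad 3 2 3 2))))
  (quad (quad (quad (quad 5 4 4 6) (quad 5 4 4 4) (quad 5 4 4 4) (quad 5 4 4 4)) (quad (quad 3 3 3 4) (quad 3 3 3 4) (quad 3 3 3 4) (quad 3 3 3 4)) (quad (quad 3 3 3 4) (quad 3 3 3 4) (quad 3 3 3 4) (quad 3 3 3 4)) (quad (quad 3 3 3 4) (quad 3 3 3 4) (quad 3 3 3 4) (quad 3 3 3 4)))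
        (quad (quad (quad 3 3 3 3) (quad 3 3 3 3) (quad 3 3 3 3) (quad 3 3 3 3)) (quad (quad 1 3 3 3) (quad 3 3 3 3) (quad 3 3 3 3) (quad 3 3 3 3)) (quad (quad 1 3 3 3) (quad 3 3 3 3) (quad 3 3 3 3) (quad 3 3 3 3)) (quad (quad 1 3 3 3) (quad 3 3 3 3) (quad 3 3 3 3) (quad 3 3 3 3)))
        (quad (quad (quad 3 2 3 2) (quad 3 2 3 2) (quad 3 2 3 2) (quad 3 2 3 2)) (quad (quad 3 2 3 2) (quad 0 2 3 2) (quad 3 2 3 2) (quad 3 2 3 2)) (quad (quad 0 2 3 2) (quad 3 2 3 2) (quad 3 2 3 2) (quad 3 2 3 2)) (quad (quad 0 2 3 2) (quad 3 2 3 2) (quad 3 2 3 2) (quad 3 2 3 2)))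
        (quad (quad (quad 3 2 3 2) (quad 3 2 3 2) (quad 0 2 3 2) (quad 3 2 3 2)) (quad (quad 3 2 3 2) (quad 0 2 3 2) (quad 3 2 3 2) (quad 3 2 3 2)) (quad (quad 3 2 3 2) (quad 3 2 3 2) (quad 3 2 3 2) (quad 3 2 3 2)) (quad (quad 3 2 3 2) (quad 3 2 3 2) (quad 3 2 3 2) (quad 3 2 3 2))))
potentialTable 3F = quad
  (quad (quad (quad (quad 0 2 0 1) (quad 6 6 6 6) (quad 6 6 6 6) (quad 6 6 6 6)) (quad (quad 6 6 6 6) (quad 6 6 6 6) (quad 6 6 6 6) (quad 6 6 6 5)) (quad (quad 6 6 6 6) (quad 6 6 6 6) (quad 6 5 6 5) (quad 5 5 5 5)) (quad (quad 6 6 6 6) (quad 6 5 6 6) (quad 5 5 5 5) (quad 5 5 5 5)))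
        (quad (quad (quad 6 6 6 6) (quad 6 6 6 6) (quad 4 6 5 5) (quad 4 6 5 5)) (quad (quad 6 6 6 6) (quad 6 6 6 6) (quad 4 6 5 5) (quad 4 6 5 5)) (quad (quad 6 4 6 5) (quad 6 4 6 5) (quad 4 3 5 5) (quad 4 3 5 5)) (quad (quad 4 3 5 4) (quad 4 3 5 4) (quad 3 3 3 3) (quad 3 3 3 3)))
        (quad (quad (quad 5 5 5 5) (quad 3 5 4 4) (quad 3 5 4 4) (quad 3 5 4 4)) (quad (quad 5 5 5 5) (quad 3 5 4 4) (quad 3 5 4 4) (quad 3 5 4 4)) (quad (quad 4 3 5 4) (quad 3 3 3 3) (quad 3 3 3 3) (quad 3 3 3 3)) (quad (quad 4 3 5 4) (quad 3 3 3 3) (quad 3 3 3 3) (quad 3 3 3 3)))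
        (quad (quad (quad 4 4 5 5) (quad 2 4 3 3) (quad 2 4 3 3) (quad 2 4 3 3)) (quad (quad 4 3 5 4) (quad 2 3 3 3) (quad 2 3 3 3) (quad 2 3 3 3)) (quad (quad 4 3 5 4) (quad 2 3 3 3) (quad 2 3 3 3) (quad 2 3 3 3)) (quad (quad 4 3 5 4) (quad 2 3 3 3) (quad 2 3 3 3) (quad 2 3 3 3))))
  (quad (quad (quad (quad 6 5 6 6) (quad 6 5 6 6) (quad 6 4 6 5) (quad 5 4 4 3)) (quad (quad 6 5 6 6) (quad 6 5 6 6) (quad 6 4 6 5) (quad 5 4 4 3)) (quad (quad 5 5 4 6) (quad 5 5 4 6) (quad 5 3 4 5) (quad 3 3 3 3)) (quad (quad 5 5 4 6) (quad 5 5 4 6) (quad 5 3 4 5) (quad 3 3 3 3)))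
        (quad (quad (quad 6 4 6 5) (quad 6 4 6 5) (quad 4 4 4 3) (quad 4 4 4 3)) (quad (quad 6 4 6 5) (quad 6 4 6 5) (quad 4 4 4 3) (quad 4 4 4 3)) (quad (quad 4 3 4 4) (quad 4 3 4 4) (quad 3 3 3 3) (quad 3 3 3 3)) (quad (quad 4 3 4 4) (quad 4 3 4 4) (quad 3 3 3 3) (quad 3 3 3 3)))
        (quad (quad (quad 3 3 3 3) (quad 1 3 3 3) (quad 1 3 3 3) (quad 3 3 3 3)) (quad (quad 1 3 3 3) (quad 3 3 3 3) (quad 3 3 3 3) (quad 3 3 3 3)) (quad (quad 3 3 3 3) (quad 3 3 3 3) (quad 3 3 3 3) (quad 3 3 3 3)) (quad (quad 3 3 3 3) (quad 3 3 3 3) (quad 3 3 3 3) (quad 3 3 3 3)))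
        (quad (quad (quad 2 3 3 3) (quad 2 3 3 3) (quad 2 3 3 3) (quad 2 3 3 3)) (quad (quad 2 3 3 3) (quad 2 3 3 3) (quad 2 3 3 3) (quad 2 3 3 3)) (quad (quad 2 3 3 3) (quad 2 3 3 3) (quad 2 3 3 3) (quad 2 3 3 3)) (quad (quad 2 3 3 3) (quad 2 3 3 3) (quad 2 3 3 3) (quad 2 3 3 3))))
  (quad (quad (quad (quad 5 5 5 5) (quad 3 5 5 5) (quad 5 4 4 3) (quad 5 4 4 3)) (quad (quad 4 4 3 5) (quad 4 4 3 5) (quad 3 3 3 3) (quad 3 3 3 3)) (quad (quad 4 4 3 5) (quad 4 4 3 5) (quad 3 3 3 3) (quad 3 3 3 3)) (quad (quad 4 4 3 5) (quad 4 4 3 5) (quad 3 3 3 3) (quad 3 3 3 3)))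
        (quad (quad (quad 3 3 3 3) (quad 1 3 3 3) (quad 3 3 3 3) (quad 3 3 3 3)) (quad (quad 3 3 3 3) (quad 3 3 3 3) (quad 3 3 3 3) (quad 3 3 3 3)) (quad (quad 3 3 3 3) (quad 3 3 3 3) (quad 3 3 3 3) (quad 3 3 3 3)) (quad (quad 3 3 3 3) (quad 3 3 3 3) (quad 3 3 3 3) (quad 3 3 3 3)))
        (quad (quad (quad 2 3 2 3) (quad 1 3 2 3) (quad 2 3 2 3) (quad 1 3 2 3)) (quad (quad 1 3 2 3) (quad 1 3 2 3) (quad 2 3 2 3) (quad 2 3 2 3)) (quad (quad 2 3 2 3) (quad 2 3 2 3) (quad 2 3 2 3) (quad 2 3 2 3)) (quad (quad 1 3 2 3) (quad 2 3 2 3) (quad 2 3 2 3) (quad 2 3 2 3)))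
        (quad (quad (quad 2 2 2 2) (quad 0 2 2 2) (quad 2 2 2 2) (quad 2 2 2 2)) (quad (quad 2 2 2 2) (quad 2 2 2 2) (quad 2 2 2 2) (quad 2 2 2 2)) (quad (quad 2 2 2 2) (quad 2 2 2 2) (quad 2 2 2 2) (quad 2 2 2 2)) (quad (quad 2 2 2 2) (quad 2 2 2 2) (quad 2 2 2 2) (quad 2 2 2 2))))
  (quad (quad (quad (quad 5 4 4 5) (quad 5 4 4 3) (quad 5 4 4 3) (quad 5 4 4 3)) (quad (quad 3 3 2 4) (quad 3 3 2 3) (quad 3 3 2 3) (quad 3 3 2 3)) (quad (quad 3 3 2 4) (quad 3 3 2 3) (quad 3 3 2 3) (quad 3 3 2 3)) (quad (quad 3 3 2 4) (quad 3 3 2 3) (quad 3 3 2 3) (quad 3 3 2 3)))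
        (quad (quad (quad 3 3 2 3) (quad 3 3 2 3) (quad 3 3 2 3) (quad 3 3 2 3)) (quad (quad 3 3 2 3) (quad 3 3 2 3) (quad 3 3 2 3) (quad 3 3 2 3)) (quad (quad 3 3 2 3) (quad 3 3 2 3) (quad 3 3 2 3) (quad 3 3 2 3)) (quad (quad 3 3 2 3) (quad 3 3 2 3) (quad 3 3 2 3) (quad 3 3 2 3)))
        (quad (quad (quad 2 2 2 2) (quad 2 2 2 2) (quad 2 2 2 2) (quad 2 2 2 2)) (quad (quad 0 2 2 2) (quad 2 2 2 2) (quad 2 2 2 2) (quad 2 2 2 2)) (quad (quad 2 2 2 2) (quad 2 2 2 2) (quad 2 2 2 2) (quad 2 2 2 2)) (quad (quad 2 2 2 2) (quad 2 2 2 2) (quad 2 2 2 2) (quad 2 2 2 2)))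
        (quad (quad (quad 2 2 2 2) (quad 2 2 2 2) (quad 2 2 2 2) (quad 2 2 2 2)) (quad (quad 0 2 2 2) (quad 2 2 2 2) (quad 2 2 2 2) (quad 2 2 2 2)) (quad (quad 2 2 2 2) (quad 2 2 2 2) (quad 2 2 2 2) (quad 2 2 2 2)) (quad (quad 2 2 2 2) (quad 2 2 2 2) (quad 2 2 2 2) (quad 2 2 2 2))))
potentialTable 4F = quad
  (quad (quad (quad (quad 0 2 0 1) (quad 7 7 7 7) (quad 7 7 7 7) (quad 7 7 7 7)) (quad (quad 7 7 7 7) (quad 7 7 7 7) (quad 7 6 6 6) (quad 6 6 5 6)) (quad (quad 7 7 7 7) (quad 6 6 7 6) (quad 6 6 6 6) (quad 6 5 5 5)) (quad (quad 7 7 7 7) (quad 5 6 6 6) (quad 5 5 6 5) (quad 5 5 5 5)))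
        (quad (quad (quad 7 5 6 6) (quad 7 5 6 6) (quad 6 5 5 4) (quad 6 5 5 4)) (quad (quad 7 5 6 6) (quad 7 5 6 6) (quad 6 5 5 4) (quad 6 5 5 4)) (quad (quad 6 5 6 6) (quad 6 5 6 6) (quad 5 5 4 4) (quad 5 5 4 4)) (quad (quad 3 5 4 4) (quad 3 5 4 4) (quad 3 4 4 4) (quad 3 4 4 4)))
        (quad (quad (quad 6 5 5 5) (quad 5 4 4 3) (quad 5 4 4 3) (quad 5 4 4 3)) (quad (quad 6 5 5 5) (quad 5 4 4 3) (quad 5 4 4 3) (quad 5 4 4 3)) (quad (quad 3 5 4 4) (quad 3 4 4 3) (quad 3 4 4 3) (quad 3 4 4 3)) (quad (quad 3 5 4 4) (quad 3 4 4 3) (quad 3 4 4 3) (quad 3 4 4 3)))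
        (quad (quad (quad 5 5 4 4) (quad 4 3 3 2) (quad 4 3 3 2) (quad 4 3 3 2)) (quad (quad 3 5 4 4) (quad 3 3 3 2) (quad 3 3 3 2) (quad 3 3 3 2)) (quad (quad 3 5 4 4) (quad 3 3 3 2) (quad 3 3 3 2) (quad 3 3 3 2)) (quad (quad 3 5 4 4) (quad 3 3 3 2) (quad 3 3 3 2) (quad 3 3 3 2))))
  (quad (quad (quad (quad 6 5 7 6) (quad 6 5 7 6) (quad 6 5 6 6) (quad 4 4 3 5)) (quad (quad 6 5 7 6) (quad 6 5 7 6) (quad 6 5 6 6) (quad 4 4 3 5)) (quad (quad 5 4 6 5) (quad 5 4 6 5) (quad 5 4 5 5) (quad 4 4 3 4)) (quad (quad 5 4 6 5) (quad 5 4 6 5) (quad 5 4 5 5) (quad 4 4 3 4)))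
        (quad (quad (quad 6 6 6 6) (quad 6 6 6 6) (quad 4 3 3 4) (quad 4 3 3 4)) (quad (quad 6 6 6 6) (quad 6 6 6 6) (quad 4 3 3 4) (quad 4 3 3 4)) (quad (quad 3 4 4 4) (quad 3 4 4 4) (quad 3 3 3 4) (quad 3 3 3 4)) (quad (quad 3 4 4 4) (quad 3 4 4 4) (quad 3 3 3 4) (quad 3 3 3 4)))
        (quad (quad (quad 3 4 3 3) (quad 3 4 3 3) (quad 3 4 3 3) (quad 3 4 3 3)) (quad (quad 3 4 3 3) (quad 3 4 3 3) (quad 3 4 3 3) (quad 3 4 3 3)) (quad (quad 2 4 3 3) (quad 3 4 3 3) (quad 3 4 3 3) (quad 3 4 3 3)) (quad (quad 2 4 3 3) (quad 3 4 3 3) (quad 3 4 3 3) (quad 3 4 3 3)))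
        (quad (quad (quad 3 3 3 2) (quad 3 3 3 2) (quad 3 3 3 2) (quad 3 3 3 2)) (quad (quad 1 3 3 2) (quad 3 3 3 2) (quad 3 3 3 2) (quad 3 3 3 2)) (quad (quad 3 3 3 2) (quad 3 3 3 2) (quad 3 3 3 2) (quad 3 3 3 2)) (quad (quad 3 3 3 2) (quad 3 3 3 2) (quad 3 3 3 2) (quad 3 3 3 2))))
  (quad (quad (quad (quad 5 4 6 5) (quad 5 4 6 5) (quad 4 4 3 5) (quad 4 4 3 5)) (quad (quad 4 3 5 4) (quad 4 3 5 4) (quad 4 3 3 4) (quad 4 3 3 4)) (quad (quad 4 3 5 4) (quad 4 3 5 4) (quad 4 3 3 4) (quad 4 3 3 4)) (quad (quad 4 3 5 4) (quad 4 3 5 4) (quad 4 3 3 4) (quad 4 3 3 4)))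
        (quad (quad (quad 3 3 3 4) (quad 3 3 3 4) (quad 3 3 3 4) (quad 3 3 3 4)) (quad (quad 3 3 3 4) (quad 1 3 3 4) (quad 3 3 3 4) (quad 3 3 3 4)) (quad (quad 3 3 3 4) (quad 3 3 3 4) (quad 3 3 3 4) (quad 3 3 3 4)) (quad (quad 3 3 3 4) (quad 3 3 3 4) (quad 3 3 3 4) (quad 3 3 3 4)))
        (quad (quad (quad 3 3 3 3) (quad 3 3 3 3) (quad 3 3 3 3) (quad 3 3 3 3)) (quad (quad 3 3 3 3) (quad 3 3 3 3) (quad 3 3 3 3) (quad 3 3 3 3)) (quad (quad 1 3 3 3) (quad 3 3 3 3) (quad 3 3 3 3) (quad 3 3 3 3)) (quad (quad 3 3 3 3) (quad 3 3 3 3) (quad 3 3 3 3) (quad 3 3 3 3)))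
        (quad (quad (quad 2 3 2 2) (quad 2 3 2 2) (quad 1 3 2 2) (quad 2 3 2 2)) (quad (quad 1 3 2 2) (quad 2 3 2 2) (quad 2 3 2 2) (quad 2 3 2 2)) (quad (quad 2 3 2 2) (quad 2 3 2 2) (quad 2 3 2 2) (quad 2 3 2 2)) (quad (quad 2 3 2 2) (quad 2 3 2 2) (quad 2 3 2 2) (quad 2 3 2 2))))
  (quad (quad (quad (quad 5 4 5 5) (quad 4 4 3 5) (quad 4 4 3 5) (quad 4 4 3 5)) (quad (quad 3 2 4 3) (quad 3 2 3 3) (quad 3 2 3 3) (quad 3 2 3 3)) (quad (quad 3 2 4 3) (quad 3 2 3 3) (quad 3 2 3 3) (quad 3 2 3 3)) (quad (quad 3 2 4 3) (quad 3 2 3 3) (quad 3 2 3 3) (quad 3 2 3 3)))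
        (quad (quad (quad 3 2 3 3) (quad 3 2 3 3) (quad 3 2 3 3) (quad 3 2 3 3)) (quad (quad 3 2 3 3) (quad 3 2 3 3) (quad 3 2 3 3) (quad 3 2 3 3)) (quad (quad 3 2 3 3) (quad 3 2 3 3) (quad 3 2 3 3) (quad 3 2 3 3)) (quad (quad 3 2 3 3) (quad 3 2 3 3) (quad 3 2 3 3) (quad 3 2 3 3)))
        (quad (quad (quad 2 2 2 3) (quad 2 2 2 3) (quad 2 2 2 3) (quad 2 2 2 3)) (quad (quad 2 2 2 3) (quad 2 2 2 3) (quad 2 2 2 3) (quad 2 2 2 3)) (quad (quad 2 2 2 3) (quad 2 2 2 3) (quad 2 2 2 3) (quad 2 2 2 3)) (quad (quad 2 2 2 3) (quad 2 2 2 3) (quad 2 2 2 3) (quad 2 2 2 3)))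
        (quad (quad (quad 2 2 2 2) (quad 0 2 2 2) (quad 2 2 2 2) (quad 2 2 2 2)) (quad (quad 2 2 2 2) (quad 2 2 2 2) (quad 2 2 2 2) (quad 2 2 2 2)) (quad (quad 2 2 2 2) (quad 2 2 2 2) (quad 2 2 2 2) (quad 2 2 2 2)) (quad (quad 2 2 2 2) (quad 2 2 2 2) (quad 2 2 2 2) (quad 2 2 2 2))))
potentialTable 5F = quad
  (quad (quad (quad (quad 0 2 0 1) (quad 6 6 6 6) (quad 6 6 6 6) (quad 6 6 6 6)) (quad (quad 6 6 6 6) (quad 6 6 6 6) (quad 5 5 6 5) (quad 4 5 6 5)) (quad (quad 6 6 6 6) (quad 6 5 5 5) (quad 5 5 5 5) (quad 4 4 5 4)) (quad (quad 6 6 6 6) (quad 6 5 4 5) (quad 5 4 4 4) (quad 4 4 4 4)))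
        (quad (quad (quad 5 4 6 5) (quad 5 4 6 5) (quad 4 3 5 5) (quad 4 3 5 5)) (quad (quad 5 4 6 5) (quad 5 4 6 5) (quad 4 3 5 5) (quad 4 3 5 5)) (quad (quad 5 4 5 5) (quad 5 4 5 5) (quad 4 3 4 4) (quad 4 3 4 4)) (quad (quad 4 3 2 4) (quad 4 3 2 4) (quad 3 3 2 3) (quad 3 3 2 3)))
        (quad (quad (quad 4 3 5 4) (quad 3 2 4 4) (quad 3 2 4 4) (quad 3 2 4 4)) (quad (quad 4 3 5 4) (quad 3 2 4 4) (quad 3 2 4 4) (quad 3 2 4 4)) (quad (quad 4 3 2 4) (quad 3 2 2 3) (quad 3 2 2 3) (quad 3 2 2 3)) (quad (quad 4 3 2 4) (quad 3 2 2 3) (quad 3 2 2 3) (quad 3 2 2 3)))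
        (quad (quad (quad 4 3 4 4) (quad 2 1 3 3) (quad 2 1 3 3) (quad 2 1 3 3)) (quad (quad 4 3 2 4) (quad 2 1 2 3) (quad 2 1 2 3) (quad 2 1 2 3)) (quad (quad 4 3 2 4) (quad 2 1 2 3) (quad 2 1 2 3) (quad 2 1 2 3)) (quad (quad 4 3 2 4) (quad 2 1 2 3) (quad 2 1 2 3) (quad 2 1 2 3))))
  (quad (quad (quad (quad 6 5 5 5) (quad 6 5 5 5) (quad 5 5 5 5) (quad 2 4 4 3)) (quad (quad 6 5 5 5) (quad 6 5 5 5) (quad 5 5 5 5) (quad 2 4 4 3)) (quad (quad 5 5 4 3) (quad 5 5 4 3) (quad 4 4 3 3) (quad 2 3 3 3)) (quad (quad 5 5 4 3) (quad 5 5 4 3) (quad 4 4 3 3) (quad 2 3 3 3)))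
        (quad (quad (quad 5 5 5 5) (quad 5 5 5 5) (quad 2 3 4 3) (quad 2 3 4 3)) (quad (quad 5 5 5 5) (quad 5 5 5 5) (quad 2 3 4 3) (quad 2 3 4 3)) (quad (quad 4 3 2 3) (quad 4 3 2 3) (quad 2 3 2 3) (quad 2 3 2 3)) (quad (quad 4 3 2 3) (quad 4 3 2 3) (quad 2 3 2 3) (quad 2 3 2 3)))
        (quad (quad (quad 2 2 2 3) (quad 2 2 2 3) (quad 2 2 2 3) (quad 2 2 2 3)) (quad (quad 2 2 2 3) (quad 2 2 2 3) (quad 2 2 2 3) (quad 2 2 2 3)) (quad (quad 2 2 2 3) (quad 2 2 2 3) (quad 2 2 2 3) (quad 2 2 2 3)) (quad (quad 2 2 2 3) (quad 2 2 2 3) (quad 2 2 2 3) (quad 2 2 2 3)))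
        (quad (quad (quad 2 1 2 3) (quad 2 1 2 3) (quad 2 1 2 3) (quad 2 1 2 3)) (quad (quad 2 1 2 3) (quad 2 1 2 3) (quad 2 1 2 3) (quad 2 1 2 3)) (quad (quad 2 1 2 3) (quad 2 1 2 3) (quad 2 1 2 3) (quad 2 1 2 3)) (quad (quad 2 1 2 3) (quad 2 1 2 3) (quad 2 1 2 3) (quad 2 1 2 3))))
  (quad (quad (quad (quad 5 4 4 4) (quad 5 4 4 4) (quad 2 4 4 3) (quad 2 4 4 3)) (quad (quad 4 4 3 2) (quad 4 4 3 2) (quad 2 3 3 2) (quad 2 3 3 2)) (quad (quad 4 4 3 2) (quad 4 4 3 2) (quad 2 3 3 2) (quad 2 3 3 2)) (quad (quad 4 4 3 2) (quad 4 4 3 2) (quad 2 3 3 2) (quad 2 3 3 2)))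
        (quad (quad (quad 2 3 2 2) (quad 2 3 2 2) (quad 1 3 2 2) (quad 1 3 2 2)) (quad (quad 2 3 2 2) (quad 2 3 2 2) (quad 2 3 2 2) (quad 2 3 2 2)) (quad (quad 2 3 2 2) (quad 2 3 2 2) (quad 2 3 2 2) (quad 2 3 2 2)) (quad (quad 2 3 2 2) (quad 2 3 2 2) (quad 2 3 2 2) (quad 2 3 2 2)))
        (quad (quad (quad 2 2 2 2) (quad 2 2 2 2) (quad 0 2 2 2) (quad 2 2 2 2)) (quad (quad 2 2 2 2) (quad 2 2 2 2) (quad 2 2 2 2) (quad 2 2 2 2)) (quad (quad 2 2 2 2) (quad 2 2 2 2) (quad 2 2 2 2) (quad 2 2 2 2)) (quad (quad 2 2 2 2) (quad 2 2 2 2) (quad 2 2 2 2) (quad 2 2 2 2)))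
        (quad (quad (quad 1 1 1 2) (quad 1 1 1 2) (quad 1 1 1 2) (quad 1 1 1 2)) (quad (quad 1 1 1 2) (quad 1 1 1 2) (quad 1 1 1 2) (quad 1 1 1 2)) (quad (quad 1 1 1 2) (quad 1 1 1 2) (quad 1 1 1 2) (quad 1 1 1 2)) (quad (quad 1 1 1 2) (quad 1 1 1 2) (quad 1 1 1 2) (quad 1 1 1 2))))
  (quad (quad (quad (quad 4 4 4 3) (quad 2 4 4 3) (quad 2 4 4 3) (quad 2 4 4 3)) (quad (quad 3 3 2 1) (quad 2 3 2 1) (quad 2 3 2 1) (quad 2 3 2 1)) (quad (quad 3 3 2 1) (quad 2 3 2 1) (quad 2 3 2 1) (quad 2 3 2 1)) (quad (quad 3 3 2 1) (quad 2 3 2 1) (quad 2 3 2 1) (quad 2 3 2 1)))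
        (quad (quad (quad 2 3 2 1) (quad 0 3 2 1) (quad 0 3 2 1) (quad 2 3 2 1)) (quad (quad 2 3 2 1) (quad 2 3 2 1) (quad 2 3 2 1) (quad 2 3 2 1)) (quad (quad 2 3 2 1) (quad 2 3 2 1) (quad 2 3 2 1) (quad 2 3 2 1)) (quad (quad 2 3 2 1) (quad 2 3 2 1) (quad 2 3 2 1) (quad 2 3 2 1)))
        (quad (quad (quad 1 2 1 1) (quad 0 2 1 1) (quad 0 2 1 1) (quad 1 2 1 1)) (quad (quad 1 2 1 1) (quad 1 2 1 1) (quad 1 2 1 1) (quad 1 2 1 1)) (quad (quad 1 2 1 1) (quad 1 2 1 1) (quad 1 2 1 1) (quad 1 2 1 1)) (quad (quad 1 2 1 1) (quad 1 2 1 1) (quad 1 2 1 1) (quad 1 2 1 1)))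
        (quad (quad (quad 1 1 1 1) (quad 1 1 1 1) (quad 1 1 1 1) (quad 1 1 1 1)) (quad (quad 1 1 1 1) (quad 1 1 1 1) (quad 1 1 1 1) (quad 1 1 1 1)) (quad (quad 1 1 1 1) (quad 1 1 1 1) (quad 1 1 1 1) (quad 1 1 1 1)) (quad (quad 1 1 1 1) (quad 1 1 1 1) (quad 1 1 1 1) (quad 1 1 1 1))))
potentialTable 6F = quad
  (quad (quad (quad (quad 0 2 0 1) (quad 5 5 5 5) (quad 5 5 5 5) (quad 5 5 5 5)) (quad (quad 5 5 5 5) (quad 5 5 5 5) (quad 5 5 5 5) (quad 5 4 5 5)) (quad (quad 5 5 5 5) (quad 5 5 5 5) (quad 5 5 5 5) (quad 4 4 4 4)) (quad (quad 5 5 5 5) (quad 5 5 5 4) (quad 4 4 4 4) (quad 4 4 4 4)))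
        (quad (quad (quad 5 5 5 5) (quad 5 5 5 5) (quad 5 4 3 5) (quad 5 4 3 5)) (quad (quad 5 5 5 5) (quad 5 5 5 5) (quad 5 4 3 5) (quad 5 4 3 5)) (quad (quad 5 5 5 5) (quad 5 5 5 5) (quad 4 4 3 4) (quad 4 4 3 4)) (quad (quad 4 4 3 2) (quad 4 4 3 2) (quad 2 2 2 2) (quad 2 2 2 2)))
        (quad (quad (quad 4 4 4 4) (quad 4 3 2 4) (quad 4 3 2 4) (quad 4 3 2 4)) (quad (quad 4 4 4 4) (quad 4 3 2 4) (quad 4 3 2 4) (quad 4 3 2 4)) (quad (quad 4 4 3 2) (quad 2 2 2 2) (quad 2 2 2 2) (quad 2 2 2 2)) (quad (quad 4 4 3 2) (quad 2 2 2 2) (quad 2 2 2 2) (quad 2 2 2 2)))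
        (quad (quad (quad 4 4 3 4) (quad 3 2 1 3) (quad 3 2 1 3) (quad 3 2 1 3)) (quad (quad 4 4 3 2) (quad 2 2 1 2) (quad 2 2 1 2) (quad 2 2 1 2)) (quad (quad 4 4 3 2) (quad 2 2 1 2) (quad 2 2 1 2) (quad 2 2 1 2)) (quad (quad 4 4 3 2) (quad 2 2 1 2) (quad 2 2 1 2) (quad 2 2 1 2))))
  (quad (quad (quad (quad 5 5 5 5) (quad 5 5 5 5) (quad 5 5 5 5) (quad 3 2 4 4)) (quad (quad 5 5 5 5) (quad 5 5 5 5) (quad 5 5 5 5) (quad 3 2 4 4)) (quad (quad 3 5 5 4) (quad 3 5 5 4) (quad 3 4 4 4) (quad 2 2 2 2)) (quad (quad 3 5 5 4) (quad 3 5 5 4) (quad 3 4 4 4) (quad 2 2 2 2)))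
        (quad (quad (quad 5 5 5 5) (quad 5 5 5 5) (quad 3 2 3 3) (quad 3 2 3 3)) (quad (quad 5 5 5 5) (quad 5 5 5 5) (quad 3 2 3 3) (quad 3 2 3 3)) (quad (quad 3 3 3 2) (quad 3 3 3 2) (quad 2 2 2 2) (quad 2 2 2 2)) (quad (quad 3 3 3 2) (quad 3 3 3 2) (quad 2 2 2 2) (quad 2 2 2 2)))
        (quad (quad (quad 2 2 2 2) (quad 2 2 2 2) (quad 2 2 2 2) (quad 2 2 2 2)) (quad (quad 2 2 2 2) (quad 2 2 2 2) (quad 2 2 2 2) (quad 2 2 2 2)) (quad (quad 2 2 2 2) (quad 2 2 2 2) (quad 2 2 2 2) (quad 2 2 2 2)) (quad (quad 2 2 2 2) (quad 2 2 2 2) (quad 2 2 2 2) (quad 2 2 2 2)))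
        (quad (quad (quad 2 2 1 2) (quad 2 2 1 2) (quad 2 2 1 2) (quad 2 2 1 2)) (quad (quad 2 2 1 2) (quad 2 2 1 2) (quad 2 2 1 2) (quad 2 2 1 2)) (quad (quad 2 2 1 2) (quad 2 2 1 2) (quad 2 2 1 2) (quad 2 2 1 2)) (quad (quad 2 2 1 2) (quad 2 2 1 2) (quad 2 2 1 2) (quad 2 2 1 2))))
  (quad (quad (quad (quad 4 4 4 4) (quad 4 4 4 4) (quad 3 2 4 4) (quad 3 2 4 4)) (quad (quad 2 4 4 3) (quad 2 4 4 3) (quad 2 2 2 2) (quad 2 2 2 2)) (quad (quad 2 4 4 3) (quad 2 4 4 3) (quad 2 2 2 2) (quad 2 2 2 2)) (quad (quad 2 4 4 3) (quad 2 4 4 3) (quad 2 2 2 2) (quad 2 2 2 2)))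
        (quad (quad (quad 2 2 2 2) (quad 2 2 2 2) (quad 2 2 2 2) (quad 2 2 2 2)) (quad (quad 0 2 2 2) (quad 2 2 2 2) (quad 2 2 2 2) (quad 2 2 2 2)) (quad (quad 0 2 2 2) (quad 2 2 2 2) (quad 2 2 2 2) (quad 2 2 2 2)) (quad (quad 2 2 2 2) (quad 2 2 2 2) (quad 2 2 2 2) (quad 2 2 2 2)))
        (quad (quad (quad 2 2 2 2) (quad 2 2 2 2) (quad 2 2 2 2) (quad 2 2 2 2)) (quad (quad 2 2 2 2) (quad 2 2 2 2) (quad 2 2 2 2) (quad 2 2 2 2)) (quad (quad 2 2 2 2) (quad 2 2 2 2) (quad 2 2 2 2) (quad 2 2 2 2)) (quad (quad 2 2 2 2) (quad 2 2 2 2) (quad 2 2 2 2) (quad 2 2 2 2)))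
        (quad (quad (quad 1 1 1 1) (quad 1 1 1 1) (quad 1 1 1 1) (quad 1 1 1 1)) (quad (quad 1 1 1 1) (quad 1 1 1 1) (quad 1 1 1 1) (quad 1 1 1 1)) (quad (quad 1 1 1 1) (quad 1 1 1 1) (quad 1 1 1 1) (quad 1 1 1 1)) (quad (quad 1 1 1 1) (quad 1 1 1 1) (quad 1 1 1 1) (quad 1 1 1 1))))
  (quad (quad (quad (quad 3 4 4 4) (quad 3 2 4 4) (quad 3 2 4 4) (quad 3 2 4 4)) (quad (quad 1 3 3 2) (quad 1 2 2 2) (quad 1 2 2 2) (quad 1 2 2 2)) (quad (quad 1 3 3 2) (quad 1 2 2 2) (quad 1 2 2 2) (quad 1 2 2 2)) (quad (quad 1 3 3 2) (quad 1 2 2 2) (quad 1 2 2 2) (quad 1 2 2 2)))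
        (quad (quad (quad 1 2 2 2) (quad 1 2 2 2) (quad 1 2 2 2) (quad 1 2 2 2)) (quad (quad 1 2 2 2) (quad 1 2 2 2) (quad 1 2 2 2) (quad 1 2 2 2)) (quad (quad 1 2 2 2) (quad 1 2 2 2) (quad 1 2 2 2) (quad 1 2 2 2)) (quad (quad 1 2 2 2) (quad 1 2 2 2) (quad 1 2 2 2) (quad 1 2 2 2)))
        (quad (quad (quad 1 1 1 1) (quad 1 1 1 1) (quad 1 1 1 1) (quad 1 1 1 1)) (quad (quad 1 1 1 1) (quad 1 1 1 1) (quad 1 1 1 1) (quad 1 1 1 1)) (quad (quad 1 1 1 1) (quad 1 1 1 1) (quad 1 1 1 1) (quad 1 1 1 1)) (quad (quad 1 1 1 1) (quad 1 1 1 1) (quad 1 1 1 1) (quad 1 1 1 1)))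
        (quad (quad (quad 1 1 1 1) (quad 1 1 1 1) (quad 1 1 1 1) (quad 1 1 1 1)) (quad (quad 1 1 1 1) (quad 1 1 1 1) (quad 1 1 1 1) (quad 1 1 1 1)) (quad (quad 1 1 1 1) (quad 1 1 1 1) (quad 1 1 1 1) (quad 1 1 1 1)) (quad (quad 1 1 1 1) (quad 1 1 1 1) (quad 1 1 1 1) (quad 1 1 1 1))))
potentialTable 7F = quad
  (quad (quad (quad (quad 0 2 0 1) (quad 6 6 6 6) (quad 6 6 6 6) (quad 6 6 6 6)) (quad (quad 6 6 6 6) (quad 6 5 6 5) (quad 6 5 6 4) (quad 6 5 5 4)) (quad (quad 6 6 6 6) (quad 6 4 6 5) (quad 5 4 5 4) (quad 5 4 5 3)) (quad (quad 6 6 6 6) (quad 5 4 6 5) (quad 5 3 5 4) (quad 5 3 5 3)))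
        (quad (quad (quad 6 5 6 4) (quad 6 5 6 4) (quad 4 5 4 4) (quad 4 5 4 4)) (quad (quad 6 5 6 4) (quad 6 5 6 4) (quad 4 5 4 4) (quad 4 5 4 4)) (quad (quad 5 4 5 4) (quad 5 4 5 4) (quad 4 4 3 3) (quad 4 4 3 3)) (quad (quad 3 3 4 3) (quad 3 3 4 3) (quad 3 3 3 3) (quad 3 3 3 3)))
        (quad (quad (quad 5 4 5 3) (quad 3 4 3 3) (quad 3 4 3 3) (quad 3 4 3 3)) (quad (quad 5 4 5 3) (quad 3 4 3 3) (quad 3 4 3 3) (quad 3 4 3 3)) (quad (quad 3 3 4 3) (quad 3 3 3 3) (quad 3 3 3 3) (quad 3 3 3 3)) (quad (quad 3 3 4 3) (quad 3 3 3 3) (quad 3 3 3 3) (quad 3 3 3 3)))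
        (quad (quad (quad 4 3 4 3) (quad 2 3 2 2) (quad 2 3 2 2) (quad 2 3 2 2)) (quad (quad 3 3 4 3) (quad 2 3 2 2) (quad 2 3 2 2) (quad 2 3 2 2)) (quad (quad 3 3 4 3) (quad 2 3 2 2) (quad 2 3 2 2) (quad 2 3 2 2)) (quad (quad 3 3 4 3) (quad 2 3 2 2) (quad 2 3 2 2) (quad 2 3 2 2))))
  (quad (quad (quad (quad 6 4 6 5) (quad 6 4 6 5) (quad 5 4 5 4) (quad 4 3 3 3)) (quad (quad 6 4 6 5) (quad 6 4 6 5) (quad 5 4 5 4) (quad 4 3 3 3)) (quad (quad 4 4 4 5) (quad 4 4 4 5) (quad 3 3 4 4) (quad 3 3 3 3)) (quad (quad 4 4 4 5) (quad 4 4 4 5) (quad 3 3 4 4) (quad 3 3 3 3)))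
        (quad (quad (quad 5 4 5 4) (quad 5 4 5 4) (quad 4 3 3 3) (quad 4 3 3 3)) (quad (quad 5 4 5 4) (quad 5 4 5 4) (quad 4 3 3 3) (quad 4 3 3 3)) (quad (quad 3 3 4 3) (quad 3 3 4 3) (quad 2 3 2 3) (quad 2 3 2 3)) (quad (quad 3 3 4 3) (quad 3 3 4 3) (quad 2 3 2 3) (quad 2 3 2 3)))
        (quad (quad (quad 1 3 2 3) (quad 1 3 2 3) (quad 1 3 2 3) (quad 1 3 2 3)) (quad (quad 1 3 2 3) (quad 1 3 2 3) (quad 1 3 2 3) (quad 1 3 2 3)) (quad (quad 1 3 2 3) (quad 1 3 2 3) (quad 1 3 2 3) (quad 1 3 2 3)) (quad (quad 1 3 2 3) (quad 1 3 2 3) (quad 1 3 2 3) (quad 1 3 2 3)))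
        (quad (quad (quad 1 3 2 2) (quad 1 3 2 2) (quad 1 3 2 2) (quad 1 3 2 2)) (quad (quad 1 3 2 2) (quad 1 3 2 2) (quad 1 3 2 2) (quad 1 3 2 2)) (quad (quad 1 3 2 2) (quad 1 3 2 2) (quad 1 3 2 2) (quad 1 3 2 2)) (quad (quad 1 3 2 2) (quad 1 3 2 2) (quad 1 3 2 2) (quad 1 3 2 2))))
  (quad (quad (quad (quad 5 3 5 4) (quad 5 3 5 4) (quad 4 3 3 3) (quad 4 3 3 3)) (quad (quad 3 3 3 4) (quad 3 3 3 4) (quad 3 3 3 3) (quad 3 3 3 3)) (quad (quad 3 3 3 4) (quad 3 3 3 4) (quad 3 3 3 3) (quad 3 3 3 3)) (quad (quad 3 3 3 4) (quad 3 3 3 4) (quad 3 3 3 3) (quad 3 3 3 3)))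
        (quad (quad (quad 2 3 1 3) (quad 2 3 1 3) (quad 2 3 1 3) (quad 2 3 1 3)) (quad (quad 2 3 1 3) (quad 2 3 1 3) (quad 2 3 1 3) (quad 2 3 1 3)) (quad (quad 2 3 1 3) (quad 2 3 1 3) (quad 2 3 1 3) (quad 2 3 1 3)) (quad (quad 1 3 1 3) (quad 2 3 1 3) (quad 2 3 1 3) (quad 2 3 1 3)))
        (quad (quad (quad 1 2 1 2) (quad 1 2 1 2) (quad 1 2 1 2) (quad 1 2 1 2)) (quad (quad 1 2 1 2) (quad 1 2 1 2) (quad 1 2 1 2) (quad 1 2 1 2)) (quad (quad 1 2 1 2) (quad 1 2 1 2) (quad 1 2 1 2) (quad 1 2 1 2)) (quad (quad 1 2 1 2) (quad 1 2 1 2) (quad 1 2 1 2) (quad 1 2 1 2)))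
        (quad (quad (quad 0 2 1 2) (quad 0 2 1 2) (quad 0 2 1 2) (quad 0 2 1 2)) (quad (quad 0 2 1 2) (quad 0 2 1 2) (quad 0 2 1 2) (quad 0 2 1 2)) (quad (quad 0 2 1 2) (quad 0 2 1 2) (quad 0 2 1 2) (quad 0 2 1 2)) (quad (quad 0 2 1 2) (quad 0 2 1 2) (quad 0 2 1 2) (quad 0 2 1 2))))
  (quad (quad (quad (quad 4 3 4 3) (quad 4 3 3 3) (quad 4 3 3 3) (quad 4 3 3 3)) (quad (quad 2 2 2 3) (quad 2 2 2 3) (quad 2 2 2 3) (quad 2 2 2 3)) (quad (quad 2 2 2 3) (quad 2 2 2 3) (quad 2 2 2 3) (quad 2 2 2 3)) (quad (quad 2 2 2 3) (quad 2 2 2 3) (quad 2 2 2 3) (quad 2 2 2 3)))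
        (quad (quad (quad 2 2 1 3) (quad 2 2 1 3) (quad 2 2 1 3) (quad 2 2 1 3)) (quad (quad 2 2 1 3) (quad 2 2 1 3) (quad 2 2 1 3) (quad 2 2 1 3)) (quad (quad 2 2 1 3) (quad 2 2 1 3) (quad 2 2 1 3) (quad 2 2 1 3)) (quad (quad 2 2 1 3) (quad 2 2 1 3) (quad 2 2 1 3) (quad 2 2 1 3)))
        (quad (quad (quad 1 2 0 2) (quad 1 2 0 2) (quad 1 2 0 2) (quad 1 2 0 2)) (quad (quad 1 2 0 2) (quad 1 2 0 2) (quad 1 2 0 2) (quad 1 2 0 2)) (quad (quad 1 2 0 2) (quad 1 2 0 2) (quad 1 2 0 2) (quad 1 2 0 2)) (quad (quad 1 2 0 2) (quad 1 2 0 2) (quad 1 2 0 2) (quad 1 2 0 2)))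
        (quad (quad (quad 0 2 0 2) (quad 0 2 0 2) (quad 0 2 0 2) (quad 0 2 0 2)) (quad (quad 0 2 0 2) (quad 0 2 0 2) (quad 0 2 0 2) (quad 0 2 0 2)) (quad (quad 0 2 0 2) (quad 0 2 0 2) (quad 0 2 0 2) (quad 0 2 0 2)) (quad (quad 0 2 0 2) (quad 0 2 0 2) (quad 0 2 0 2) (quad 0 2 0 2))))
potentialTable 8F = quad
  (quad (quad (quad (quad 0 2 0 1) (quad 6 6 6 6) (quad 6 6 6 6) (quad 6 6 6 6)) (quad (quad 6 6 6 6) (quad 6 5 6 5) (quad 6 4 6 5) (quad 5 4 6 5)) (quad (quad 6 6 6 6) (quad 6 5 6 4) (quad 5 4 5 4) (quad 5 3 5 4)) (quad (quad 6 6 6 6) (quad 6 5 5 4) (quad 5 4 5 3) (quad 5 3 5 3)))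
        (quad (quad (quad 6 4 6 5) (quad 6 4 6 5) (quad 4 4 4 5) (quad 4 4 4 5)) (quad (quad 6 4 6 5) (quad 6 4 6 5) (quad 4 4 4 5) (quad 4 4 4 5)) (quad (quad 5 4 5 4) (quad 5 4 5 4) (quad 3 3 4 4) (quad 3 3 4 4)) (quad (quad 4 3 3 3) (quad 4 3 3 3) (quad 3 3 3 3) (quad 3 3 3 3)))
        (quad (quad (quad 5 3 5 4) (quad 3 3 3 4) (quad 3 3 3 4) (quad 3 3 3 4)) (quad (quad 5 3 5 4) (quad 3 3 3 4) (quad 3 3 3 4) (quad 3 3 3 4)) (quad (quad 4 3 3 3) (quad 3 3 3 3) (quad 3 3 3 3) (quad 3 3 3 3)) (quad (quad 4 3 3 3) (quad 3 3 3 3) (quad 3 3 3 3) (quad 3 3 3 3)))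
        (quad (quad (quad 4 3 3 3) (quad 2 2 2 3) (quad 2 2 2 3) (quad 2 2 2 3)) (quad (quad 4 3 3 3) (quad 2 2 2 3) (quad 2 2 2 3) (quad 2 2 2 3)) (quad (quad 4 3 3 3) (quad 2 2 2 3) (quad 2 2 2 3) (quad 2 2 2 3)) (quad (quad 4 3 3 3) (quad 2 2 2 3) (quad 2 2 2 3) (quad 2 2 2 3))))
  (quad (quad (quad (quad 6 5 6 4) (quad 6 5 6 4) (quad 5 4 5 4) (quad 3 3 4 3)) (quad (quad 6 5 6 4) (quad 6 5 6 4) (quad 5 4 5 4) (quad 3 3 4 3)) (quad (quad 4 5 4 4) (quad 4 5 4 4) (quad 4 4 3 3) (quad 3 3 3 3)) (quad (quad 4 5 4 4) (quad 4 5 4 4) (quad 4 4 3 3) (quad 3 3 3 3)))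
        (quad (quad (quad 5 4 5 4) (quad 5 4 5 4) (quad 3 2 4 3) (quad 3 2 4 3)) (quad (quad 5 4 5 4) (quad 5 4 5 4) (quad 3 2 4 3) (quad 3 2 4 3)) (quad (quad 4 3 3 3) (quad 4 3 3 3) (quad 2 2 2 3) (quad 2 2 2 3)) (quad (quad 4 3 3 3) (quad 4 3 3 3) (quad 2 2 2 3) (quad 2 2 2 3)))
        (quad (quad (quad 2 3 1 3) (quad 2 3 1 3) (quad 2 3 1 3) (quad 2 3 1 3)) (quad (quad 2 3 1 3) (quad 2 3 1 3) (quad 2 3 1 3) (quad 2 3 1 3)) (quad (quad 2 3 1 3) (quad 2 3 1 3) (quad 2 3 1 3) (quad 2 3 1 3)) (quad (quad 2 3 1 3) (quad 2 3 1 3) (quad 2 3 1 3) (quad 2 3 1 3)))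
        (quad (quad (quad 2 2 1 3) (quad 2 2 1 3) (quad 2 2 1 3) (quad 2 2 1 3)) (quad (quad 2 2 1 3) (quad 2 2 1 3) (quad 2 2 1 3) (quad 2 2 1 3)) (quad (quad 2 2 1 3) (quad 2 2 1 3) (quad 2 2 1 3) (quad 2 2 1 3)) (quad (quad 2 2 1 3) (quad 2 2 1 3) (quad 2 2 1 3) (quad 2 2 1 3))))
  (quad (quad (quad (quad 5 4 5 3) (quad 5 4 5 3) (quad 3 3 4 3) (quad 3 3 4 3)) (quad (quad 3 4 3 3) (quad 3 4 3 3) (quad 3 3 3 3) (quad 3 3 3 3)) (quad (quad 3 4 3 3) (quad 3 4 3 3) (quad 3 3 3 3) (quad 3 3 3 3)) (quad (quad 3 4 3 3) (quad 3 4 3 3) (quad 3 3 3 3) (quad 3 3 3 3)))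
        (quad (quad (quad 1 3 2 3) (quad 1 3 2 3) (quad 1 3 2 3) (quad 1 3 2 3)) (quad (quad 1 3 2 3) (quad 1 3 2 3) (quad 1 3 2 3) (quad 1 3 2 3)) (quad (quad 1 3 2 3) (quad 1 3 2 3) (quad 1 3 2 3) (quad 1 3 2 3)) (quad (quad 1 3 2 3) (quad 1 3 2 3) (quad 1 3 2 3) (quad 1 3 2 3)))
        (quad (quad (quad 1 2 1 2) (quad 1 2 1 2) (quad 1 2 1 2) (quad 1 2 1 2)) (quad (quad 1 2 1 2) (quad 1 2 1 2) (quad 1 2 1 2) (quad 1 2 1 2)) (quad (quad 1 2 1 2) (quad 1 2 1 2) (quad 1 2 1 2) (quad 1 2 1 2)) (quad (quad 1 2 1 2) (quad 1 2 1 2) (quad 1 2 1 2) (quad 1 2 1 2)))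
        (quad (quad (quad 1 2 0 2) (quad 1 2 0 2) (quad 1 2 0 2) (quad 1 2 0 2)) (quad (quad 1 2 0 2) (quad 1 2 0 2) (quad 1 2 0 2) (quad 1 2 0 2)) (quad (quad 1 2 0 2) (quad 1 2 0 2) (quad 1 2 0 2) (quad 1 2 0 2)) (quad (quad 1 2 0 2) (quad 1 2 0 2) (quad 1 2 0 2) (quad 1 2 0 2))))
  (quad (quad (quad (quad 4 3 4 3) (quad 3 3 4 3) (quad 3 3 4 3) (quad 3 3 4 3)) (quad (quad 2 3 2 2) (quad 1 3 2 2) (quad 2 3 2 2) (quad 2 3 2 2)) (quad (quad 2 3 2 2) (quad 2 3 2 2) (quad 2 3 2 2) (quad 2 3 2 2)) (quad (quad 2 3 2 2) (quad 2 3 2 2) (quad 2 3 2 2) (quad 2 3 2 2)))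
        (quad (quad (quad 1 3 2 2) (quad 1 3 2 2) (quad 1 3 2 2) (quad 1 3 2 2)) (quad (quad 1 3 2 2) (quad 1 3 2 2) (quad 1 3 2 2) (quad 1 3 2 2)) (quad (quad 1 3 2 2) (quad 1 3 2 2) (quad 1 3 2 2) (quad 1 3 2 2)) (quad (quad 1 3 2 2) (quad 1 3 2 2) (quad 1 3 2 2) (quad 1 3 2 2)))
        (quad (quad (quad 0 2 1 2) (quad 0 2 1 2) (quad 0 2 1 2) (quad 0 2 1 2)) (quad (quad 0 2 1 2) (quad 0 2 1 2) (quad 0 2 1 2) (quad 0 2 1 2)) (quad (quad 0 2 1 2) (quad 0 2 1 2) (quad 0 2 1 2) (quad 0 2 1 2)) (quad (quad 0 2 1 2) (quad 0 2 1 2) (quad 0 2 1 2) (quad 0 2 1 2)))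
        (quad (quad (quad 0 2 0 2) (quad 0 2 0 2) (quad 0 2 0 2) (quad 0 2 0 2)) (quad (quad 0 2 0 2) (quad 0 2 0 2) (quad 0 2 0 2) (quad 0 2 0 2)) (quad (quad 0 2 0 2) (quad 0 2 0 2) (quad 0 2 0 2) (quad 0 2 0 2)) (quad (quad 0 2 0 2) (quad 0 2 0 2) (quad 0 2 0 2) (quad 0 2 0 2))))
potentialTable 9F = quad
  (quad (quad (quad (quad 0 2 0 1) (quad 5 5 5 5) (quad 5 5 5 5) (quad 5 5 5 5)) (quad (quad 5 5 5 5) (quad 5 5 5 5) (quad 5 4 5 4) (quad 5 4 5 4)) (quad (quad 5 5 5 5) (quad 5 4 5 4) (quad 5 3 5 3) (quad 4 3 4 3)) (quad (quad 5 5 5 5) (quad 5 4 5 4) (quad 4 3 4 3) (quad 4 3 4 3)))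
        (quad (quad (quad 5 4 5 4) (quad 5 4 5 4) (quad 4 4 4 4) (quad 4 4 4 4)) (quad (quad 5 4 5 4) (quad 5 4 5 4) (quad 4 4 4 4) (quad 4 4 4 4)) (quad (quad 5 3 5 3) (quad 5 3 5 3) (quad 3 3 3 3) (quad 3 3 3 3)) (quad (quad 3 3 3 3) (quad 3 3 3 3) (quad 2 2 2 2) (quad 2 2 2 2)))
        (quad (quad (quad 4 3 4 3) (quad 3 3 3 3) (quad 3 3 3 3) (quad 3 3 3 3)) (quad (quad 4 3 4 3) (quad 3 3 3 3) (quad 3 3 3 3) (quad 3 3 3 3)) (quad (quad 3 3 3 3) (quad 2 2 2 2) (quad 2 2 2 2) (quad 2 2 2 2)) (quad (quad 3 3 3 3) (quad 2 2 2 2) (quad 2 2 2 2) (quad 2 2 2 2)))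
        (quad (quad (quad 4 3 4 3) (quad 2 2 2 2) (quad 2 2 2 2) (quad 2 2 2 2)) (quad (quad 3 3 3 3) (quad 2 2 2 2) (quad 2 2 2 2) (quad 2 2 2 2)) (quad (quad 3 3 3 3) (quad 2 2 2 2) (quad 2 2 2 2) (quad 2 2 2 2)) (quad (quad 3 3 3 3) (quad 2 2 2 2) (quad 2 2 2 2) (quad 2 2 2 2))))
  (quad (quad (quad (quad 5 4 5 4) (quad 5 4 5 4) (quad 5 3 5 3) (quad 3 3 3 3)) (quad (quad 5 4 5 4) (quad 5 4 5 4) (quad 5 3 5 3) (quad 3 3 3 3)) (quad (quad 4 4 4 4) (quad 4 4 4 4) (quad 3 3 3 3) (quad 2 2 2 2)) (quad (quad 4 4 4 4) (quad 4 4 4 4) (quad 3 3 3 3) (quad 2 2 2 2)))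
        (quad (quad (quad 5 3 5 3) (quad 5 3 5 3) (quad 3 3 3 3) (quad 3 3 3 3)) (quad (quad 5 3 5 3) (quad 5 3 5 3) (quad 3 3 3 3) (quad 3 3 3 3)) (quad (quad 3 3 3 3) (quad 3 3 3 3) (quad 2 2 2 2) (quad 2 2 2 2)) (quad (quad 3 3 3 3) (quad 3 3 3 3) (quad 2 2 2 2) (quad 2 2 2 2)))
        (quad (quad (quad 1 2 1 2) (quad 1 2 1 2) (quad 1 2 1 2) (quad 1 2 1 2)) (quad (quad 1 2 1 2) (quad 1 2 1 2) (quad 1 2 1 2) (quad 1 2 1 2)) (quad (quad 1 2 1 2) (quad 1 2 1 2) (quad 1 2 1 2) (quad 1 2 1 2)) (quad (quad 1 2 1 2) (quad 1 2 1 2) (quad 1 2 1 2) (quad 1 2 1 2)))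
        (quad (quad (quad 1 2 1 2) (quad 1 2 1 2) (quad 1 2 1 2) (quad 1 2 1 2)) (quad (quad 1 2 1 2) (quad 1 2 1 2) (quad 1 2 1 2) (quad 1 2 1 2)) (quad (quad 1 2 1 2) (quad 1 2 1 2) (quad 1 2 1 2) (quad 1 2 1 2)) (quad (quad 1 2 1 2) (quad 1 2 1 2) (quad 1 2 1 2) (quad 1 2 1 2))))
  (quad (quad (quad (quad 4 3 4 3) (quad 4 3 4 3) (quad 3 3 3 3) (quad 3 3 3 3)) (quad (quad 3 3 3 3) (quad 3 3 3 3) (quad 2 2 2 2) (quad 2 2 2 2)) (quad (quad 3 3 3 3) (quad 3 3 3 3) (quad 2 2 2 2) (quad 2 2 2 2)) (quad (quad 3 3 3 3) (quad 3 3 3 3) (quad 2 2 2 2) (quad 2 2 2 2)))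
        (quad (quad (quad 1 2 1 2) (quad 1 2 1 2) (quad 1 2 1 2) (quad 1 2 1 2)) (quad (quad 1 2 1 2) (quad 1 2 1 2) (quad 1 2 1 2) (quad 1 2 1 2)) (quad (quad 1 2 1 2) (quad 1 2 1 2) (quad 1 2 1 2) (quad 1 2 1 2)) (quad (quad 1 2 1 2) (quad 1 2 1 2) (quad 1 2 1 2) (quad 1 2 1 2)))
        (quad (quad (quad 0 2 0 2) (quad 0 2 0 2) (quad 0 2 0 2) (quad 0 2 0 2)) (quad (quad 0 2 0 2) (quad 0 2 0 2) (quad 0 2 0 2) (quad 0 2 0 2)) (quad (quad 0 2 0 2) (quad 0 2 0 2) (quad 0 2 0 2) (quad 0 2 0 2)) (quad (quad 0 2 0 2) (quad 0 2 0 2) (quad 0 2 0 2) (quad 0 2 0 2)))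
        (quad (quad (quad 0 1 0 1) (quad 0 1 0 1) (quad 0 1 0 1) (quad 0 1 0 1)) (quad (quad 0 1 0 1) (quad 0 1 0 1) (quad 0 1 0 1) (quad 0 1 0 1)) (quad (quad 0 1 0 1) (quad 0 1 0 1) (quad 0 1 0 1) (quad 0 1 0 1)) (quad (quad 0 1 0 1) (quad 0 1 0 1) (quad 0 1 0 1) (quad 0 1 0 1))))
  (quad (quad (quad (quad 4 3 4 3) (quad 3 3 3 3) (quad 3 3 3 3) (quad 3 3 3 3)) (quad (quad 2 2 2 2) (quad 2 2 2 2) (quad 2 2 2 2) (quad 2 2 2 2)) (quad (quad 2 2 2 2) (quad 2 2 2 2) (quad 2 2 2 2) (quad 2 2 2 2)) (quad (quad 2 2 2 2) (quad 2 2 2 2) (quad 2 2 2 2) (quad 2 2 2 2)))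
        (quad (quad (quad 1 2 1 2) (quad 1 2 1 2) (quad 1 2 1 2) (quad 1 2 1 2)) (quad (quad 1 2 1 2) (quad 1 2 1 2) (quad 1 2 1 2) (quad 1 2 1 2)) (quad (quad 1 2 1 2) (quad 1 2 1 2) (quad 1 2 1 2) (quad 1 2 1 2)) (quad (quad 1 2 1 2) (quad 1 2 1 2) (quad 1 2 1 2) (quad 1 2 1 2)))
        (quad (quad (quad 0 1 0 1) (quad 0 1 0 1) (quad 0 1 0 1) (quad 0 1 0 1)) (quad (quad 0 1 0 1) (quad 0 1 0 1) (quad 0 1 0 1) (quad 0 1 0 1)) (quad (quad 0 1 0 1) (quad 0 1 0 1) (quad 0 1 0 1) (quad 0 1 0 1)) (quad (quad 0 1 0 1) (quad 0 1 0 1) (quad 0 1 0 1) (quad 0 1 0 1)))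
        (quad (quad (quad 0 1 0 1) (quad 0 1 0 1) (quad 0 1 0 1) (quad 0 1 0 1)) (quad (quad 0 1 0 1) (quad 0 1 0 1) (quad 0 1 0 1) (quad 0 1 0 1)) (quad (quad 0 1 0 1) (quad 0 1 0 1) (quad 0 1 0 1) (quad 0 1 0 1)) (quad (quad 0 1 0 1) (quad 0 1 0 1) (quad 0 1 0 1) (quad 0 1 0 1))))

startClassTable : Quad (Quad (Quad (Quad Class)))
startClassTable = quad
  (quad (quad (quad 0F 0F 0F 0F) (quad 0F 0F 0F 0F) (quad 0F 1F 2F 0F) (quad 0F 1F 1F 0F))
        (quad (quad 0F 0F 3F 3F) (quad 0F 0F 0F 0F) (quad 1F 0F 0F 0F) (quad 4F 1F 1F 0F))
        (quad (quad 0F 3F 3F 3F) (quad 0F 2F 0F 0F) (quad 4F 1F 0F 0F) (quad 1F 1F 0F 0F))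
        (quad (quad 0F 3F 3F 3F) (quad 4F 2F 0F 0F) (quad 1F 1F 0F 0F) (quad 0F 1F 0F 0F)))
  (quad (quad (quad 0F 0F 2F 5F) (quad 0F 0F 0F 0F) (quad 6F 1F 1F 0F) (quad 6F 1F 1F 0F))
        (quad (quad 1F 0F 0F 0F) (quad 0F 0F 0F 0F) (quad 1F 0F 0F 0F) (quad 1F 0F 0F 0F))
        (quad (quad 7F 3F 3F 7F) (quad 3F 2F 0F 0F) (quad 4F 1F 0F 0F) (quad 4F 1F 0F 0F))
        (quad (quad 7F 2F 2F 2F) (quad 4F 2F 0F 0F) (quad 1F 0F 0F 0F) (quad 1F 0F 0F 0F)))
  (quad (quad (quad 0F 3F 5F 0F) (quad 6F 6F 0F 0F) (quad 6F 1F 0F 0F) (quad 6F 1F 0F 0F))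
        (quad (quad 8F 3F 5F 5F) (quad 6F 4F 0F 0F) (quad 6F 0F 0F 0F) (quad 7F 0F 0F 0F))
        (quad (quad 9F 3F 5F 3F) (quad 3F 3F 0F 0F) (quad 4F 0F 0F 0F) (quad 3F 0F 0F 0F))
        (quad (quad 7F 3F 4F 2F) (quad 4F 2F 0F 0F) (quad 1F 0F 0F 0F) (quad 1F 0F 0F 0F)))
  (quad (quad (quad 0F 5F 0F 0F) (quad 6F 8F 0F 0F) (quad 6F 1F 0F 0F) (quad 6F 1F 0F 0F))
        (quad (quad 8F 5F 5F 0F) (quad 2F 1F 0F 0F) (quad 2F 0F 0F 0F) (quad 2F 0F 0F 0F))
        (quad (quad 8F 5F 5F 0F) (quad 3F 2F 0F 0F) (quad 2F 0F 0F 0F) (quad 2F 0F 0F 0F))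
        (quad (quad 7F 4F 2F 0F) (quad 3F 2F 0F 0F) (quad 1F 0F 0F 0F) (quad 1F 0F 0F 0F)))

potential : Class → ℤ₄ → Column → Column → ℤ
potential c r (a , b) (d , e) = + (potentialTable c !ᴸ a !ᴸ b !ᴸ d !ᴸ e !₄ r)

startClass : Column → Column → Class
startClass (a , b) (d , e) = startClassTable !ᴸ a !ᴸ b !ᴸ d !ᴸ e

potential-decreasing : ∀ {x y z} → ValidTriple x y z → ∀ c r →
  potential c (suc₄ r) y z ℤ.+ + 1 ℤ.≤ colSum x ℤ.+ potential c r x y
potential-decreasing {x} {y} {z} = from-yes
  (∀-Column? λ x → ∀-Column? λ y → ∀-Column? λ z → validTriple? x y z →-dec
   (Fin.all? λ c → ∀-ℤ₄? λ r → potential c (suc₄ r) y z ℤ.+ + 1 ≤? colSum x ℤ.+ potential c r x y))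
  x y z

potential-endpoint : ∀ x y r → let c = startClass x y in
  + excess r ℤ.+ potential c 0₄ x y ℤ.≤ potential c r x y
potential-endpoint = from-yes
  (∀-Column? λ x → ∀-Column? λ y → ∀-ℤ₄? λ r →
   + excess r ℤ.+ potential (startClass x y) 0₄ x y ≤? potential (startClass x y) r x y)

-- The cycle ℤ_m and the neighbourhoods of the prism, for m = 3 + n

module Cycle (n : ℕ) where

  m : ℕ
  m = 3 + n

  next : Fin m → Fin m
  next i = fromℕ< (m%n<n (suc (toℕ i)) m)

  prev : Fin m → Fin m
  prev zero    = fromℕ (2 + n)
  prev (suc j) = inject₁ j

  Wraps : Fin m → Set
  Wraps i = suc (toℕ i) ≡ m

  wraps? : ∀ i → suc (toℕ i) < m ⊎ Wraps i
  wraps? i = ℕ.m≤n⇒m<n∨m≡n (Fin.toℕ<n i)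

  toℕ-next-< : ∀ i → suc (toℕ i) < m → toℕ (next i) ≡ suc (toℕ i)
  toℕ-next-< i i+1<m = trans (Fin.toℕ-fromℕ< _) (m<n⇒m%n≡m i+1<m)

  toℕ-next-wraps : ∀ i → Wraps i → toℕ (next i) ≡ 0
  toℕ-next-wraps i wraps = trans (Fin.toℕ-fromℕ< _) (trans (cong (_% m) wraps) (n%n≡0 m))

  predCyclic : ℕ → ℕ
  predCyclic zero    = 2 + n
  predCyclic (suc k) = k

  toℕ-prev : ∀ i → toℕ (prev i) ≡ predCyclic (toℕ i)
  toℕ-prev zero    = Fin.toℕ-fromℕ (2 + n)
  toℕ-prev (suc j) = Fin.toℕ-inject₁ j

  prev-next : ∀ i → prev (next i) ≡ i
  prev-next i = Fin.toℕ-injective (trans (toℕ-prev (next i)) (byWrap (wraps? i)))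
    where
    byWrap : suc (toℕ i) < m ⊎ Wraps i → predCyclic (toℕ (next i)) ≡ toℕ i
    byWrap (inj₁ i+1<m) = cong predCyclic (toℕ-next-< i i+1<m)
    byWrap (inj₂ wraps) = trans (cong predCyclic (toℕ-next-wraps i wraps)) (sym (ℕ.suc-injective wraps))

  next-prev : ∀ i → next (prev i) ≡ i
  next-prev zero    = Fin.toℕ-injective (toℕ-next-wraps (prev zero) (cong suc (toℕ-prev zero)))
  next-prev (suc j) = Fin.toℕ-injective (trans (toℕ-next-< (prev (suc j)) j+1<m) (cong suc (toℕ-prev (suc j))))
    where
    j+1<m : suc (toℕ (prev (suc j))) < m
    j+1<m = subst (λ k → suc k < m) (sym (toℕ-prev (suc j))) (Fin.toℕ<n (suc j))

  next≢ : ∀ i → next i ≢ i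
  next≢ i next≡i with wraps? i
  ... | inj₁ i+1<m = ℕ.1+n≢n (trans (sym (toℕ-next-< i i+1<m)) (cong toℕ next≡i))
  ... | inj₂ wraps = ℕ.0≢1+n (trans (trans (sym (toℕ-next-wraps i wraps)) (cong toℕ next≡i)) (ℕ.suc-injective wraps))

  prev≢ : ∀ i → prev i ≢ i
  prev≢ i prev≡i = next≢ i (trans (cong next (sym prev≡i)) (next-prev i))

  -- Here m ≥ 3 is needed: on a 2-cycle the two neighbours of a vertex coincide.
  next²≢ : ∀ i → next (next i) ≢ i
  next²≢ i next²≡i with wraps? i | wraps? (next i)
  ... | inj₁ i+1<m | inj₁ i+2<m = ℕ.<⇒≢ (ℕ.m<n⇒m<1+n (ℕ.n<1+n (toℕ i)))
          (sym (trans (sym (trans (toℕ-next-< (next i) i+2<m) (cong suc (toℕ-next-< i i+1<m)))) (cong toℕ next²≡i)))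
  ... | inj₁ i+1<m | inj₂ wraps′ = ℕ.0≢1+n (trans (trans (sym (toℕ-next-wraps (next i) wraps′)) (cong toℕ next²≡i))
          (ℕ.suc-injective (ℕ.suc-injective (trans (cong suc (sym (toℕ-next-< i i+1<m))) wraps′))))
  ... | inj₂ wraps | inj₁ i+2<m = ℕ.0≢1+n (ℕ.suc-injective (trans (trans (sym (trans (toℕ-next-< (next i) i+2<m) (cong suc (toℕ-next-wraps i wraps)))) (cong toℕ next²≡i))
          (ℕ.suc-injective wraps)))
  ... | inj₂ wraps | inj₂ wraps′ = ℕ.0≢1+n (ℕ.suc-injective (trans (cong suc (sym (toℕ-next-wraps i wraps))) wraps′))

  prev≢next : ∀ i → prev i ≢ next i
  prev≢next i prev≡next = next²≢ i (trans (cong next (sym prev≡next)) (next-prev i))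

  cycSucc-next : ∀ i → CycSucc m i (next i)
  cycSucc-next i with wraps? i
  ... | inj₁ i+1<m = inj₁ (toℕ-next-< i i+1<m)
  ... | inj₂ wraps = inj₂ (wraps , toℕ-next-wraps i wraps)

  cycSucc⇒next : ∀ {i j} → CycSucc m i j → j ≡ next i
  cycSucc⇒next {i} {j} (inj₁ j≡i+1) =
    Fin.toℕ-injective (trans j≡i+1 (sym (toℕ-next-< i (subst (_< m) j≡i+1 (Fin.toℕ<n j)))))
  cycSucc⇒next {i} (inj₂ (wraps , j≡0)) = Fin.toℕ-injective (trans j≡0 (sym (toℕ-next-wraps i wraps)))

  cycSucc⇒prev : ∀ {i j} → CycSucc m j i → j ≡ prev i
  cycSucc⇒prev {j = j} j→i = trans (sym (prev-next j)) (cong prev (sym (cycSucc⇒next j→i)))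

  cycSucc-prev : ∀ i → CycSucc m (prev i) i
  cycSucc-prev i = subst (CycSucc m (prev i)) (next-prev i) (cycSucc-next (prev i))

  adj-prev : ∀ b i → Adj m (b , i) (b , prev i)
  adj-prev b i = inj₁ (refl , inj₂ (cycSucc-prev i))

  adj-next : ∀ b i → Adj m (b , i) (b , next i)
  adj-next b i = inj₁ (refl , inj₁ (cycSucc-next i))

  adj-across : ∀ b i → Adj m (b , i) (not b , i)
  adj-across b i = inj₂ (Bool.not-¬ refl , refl)

  adj-cases : ∀ b i {w} → Adj m (b , i) w → w ≡ (b , prev i) ⊎ w ≡ (b , next i) ⊎ w ≡ (not b , i)
  adj-cases b i (inj₁ (refl , inj₁ i→j)) = inj₂ (inj₁ (cong (b ,_) (cycSucc⇒next i→j)))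
  adj-cases b i (inj₁ (refl , inj₂ j→i)) = inj₁ (cong (b ,_) (cycSucc⇒prev j→i))
  adj-cases b i (inj₂ (b≢c , refl))      = inj₂ (inj₂ (cong (_, i) (Bool.¬-not (b≢c ∘ sym))))

  module _ (f : PVertex m → Label) (b : Bool) (i : Fin m) where

    private
      g : PVertex m → ℤ
      g = proj₁ (summand m f (b , i))
      a p q r : ℤ
      a = val (f (b , i))
      p = val (f (b , prev i))
      q = val (f (b , next i))
      r = val (f (not b , i))

    ∑-ownRow : ∑[ j < m ] g (b , j) ≡ a ℤ.+ (p ℤ.+ q)
    ∑-ownRow = begin
      ∑[ j < m ] g (b , j)
        ≡⟨ sum-cong-≗ pointwise ⟩
      ∑[ j < m ] (δ i a j ℤ.+ (δ (prev i) p j ℤ.+ δ (next i) q j))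
        ≡⟨ ∑-distrib-+ (δ i a) (λ j → δ (prev i) p j ℤ.+ δ (next i) q j) ⟩
      ∑[ j < m ] δ i a j ℤ.+ ∑[ j < m ] (δ (prev i) p j ℤ.+ δ (next i) q j)
        ≡⟨ cong₂ ℤ._+_ (∑-δ i a) (trans (∑-distrib-+ (δ (prev i) p) (δ (next i) q)) (cong₂ ℤ._+_ (∑-δ (prev i) p) (∑-δ (next i) q))) ⟩
      a ℤ.+ (p ℤ.+ q) ∎
      where
      open ≡-Reasoning
      pointwise : ∀ j → g (b , j) ≡ δ i a j ℤ.+ (δ (prev i) p j ℤ.+ δ (next i) q j)
      pointwise j = byCases (j Fin.≟ i) (j Fin.≟ prev i) (j Fin.≟ next i)
        where
        byCases : Dec (j ≡ i) → Dec (j ≡ prev i) → Dec (j ≡ next i) →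
                  g (b , j) ≡ δ i a j ℤ.+ (δ (prev i) p j ℤ.+ δ (next i) q j)
        byCases (yes refl) _ _ =
          trans (summand-in m f (b , i) (b , i) (inj₁ refl))
                (sym (trans (cong₂ ℤ._+_ (δ-self i a) (cong₂ ℤ._+_ (δ-≢ p (prev≢ i ∘ sym)) (δ-≢ q (next≢ i ∘ sym))))
                            (ℤ.+-identityʳ a)))
        byCases (no j≢i) (yes refl) _ =
          trans (summand-in m f (b , i) (b , prev i) (inj₂ (adj-prev b i)))
                (sym (trans (cong₂ ℤ._+_ (δ-≢ a j≢i) (cong₂ ℤ._+_ (δ-self (prev i) p) (δ-≢ q (prev≢next i))))
                            (trans (ℤ.+-identityˡ _) (ℤ.+-identityʳ p))))
        byCases (no j≢i) (no _) (yes refl) =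
          trans (summand-in m f (b , i) (b , next i) (inj₂ (adj-next b i)))
                (sym (trans (cong₂ ℤ._+_ (δ-≢ a j≢i) (cong₂ ℤ._+_ (δ-≢ p (prev≢next i ∘ sym)) (δ-self (next i) q)))
                            (trans (ℤ.+-identityˡ _) (ℤ.+-identityˡ q))))
        byCases (no j≢i) (no j≢prev) (no j≢next) =
          trans (summand-out m f (b , i) (b , j) outside)
                (sym (cong₂ ℤ._+_ (δ-≢ a j≢i) (cong₂ ℤ._+_ (δ-≢ p j≢prev) (δ-≢ q j≢next))))
          where
          outside : ¬ ((b , i) ≡ (b , j) ⊎ Adj m (b , i) (b , j))
          outside (inj₁ refl) = j≢i refl
          outside (inj₂ adj) with adj-cases b i adj
          ... | inj₁ refl        = j≢prev refl
          ... | inj₂ (inj₁ refl) = j≢next refl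
          ... | inj₂ (inj₂ b≡¬b) = Bool.not-¬ refl (cong proj₁ b≡¬b)

    ∑-otherRow : ∑[ j < m ] g (not b , j) ≡ r
    ∑-otherRow = trans (sum-cong-≗ pointwise) (∑-δ i r)
      where
      pointwise : ∀ j → g (not b , j) ≡ δ i r j
      pointwise j = byCases (j Fin.≟ i)
        where
        byCases : Dec (j ≡ i) → g (not b , j) ≡ δ i r j
        byCases (yes refl) = trans (summand-in m f (b , i) (not b , i) (inj₂ (adj-across b i))) (sym (δ-self i r))
        byCases (no j≢i)   = trans (summand-out m f (b , i) (not b , j) outside) (sym (δ-≢ r j≢i))
          where
          outside : ¬ ((b , i) ≡ (not b , j) ⊎ Adj m (b , i) (not b , j))
          outside (inj₁ b,i≡¬b,j) = Bool.not-¬ refl (cong proj₁ b,i≡¬b,j)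
          outside (inj₂ adj) with adj-cases b i adj
          ... | inj₁ ¬b≡b        = Bool.not-¬ refl (sym (cong proj₁ ¬b≡b))
          ... | inj₂ (inj₁ ¬b≡b) = Bool.not-¬ refl (sym (cong proj₁ ¬b≡b))
          ... | inj₂ (inj₂ refl) = j≢i refl

  closedNbhdSum-local : ∀ f b i → closedNbhdSum m f (b , i) ≡
    val (f (b , i)) ℤ.+ (val (f (b , prev i)) ℤ.+ (val (f (b , next i)) ℤ.+ val (f (not b , i))))
  closedNbhdSum-local f true i =
    trans (sumℤ-allV m (proj₁ (summand m f (true , i))))
          (trans (cong₂ ℤ._+_ (∑-ownRow f true i) (cong (λ s → s ℤ.+ + 0) (∑-otherRow f true i)))
                 (regroup (val (f (true , i))) (val (f (true , prev i))) (val (f (true , next i))) (val (f (false , i)))))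
    where
    regroup : ∀ a p q r → a ℤ.+ (p ℤ.+ q) ℤ.+ (r ℤ.+ + 0) ≡ a ℤ.+ (p ℤ.+ (q ℤ.+ r))
    regroup = solve-∀
  closedNbhdSum-local f false i =
    trans (sumℤ-allV m (proj₁ (summand m f (false , i))))
          (trans (cong₂ ℤ._+_ (∑-otherRow f false i) (cong (λ s → s ℤ.+ + 0) (∑-ownRow f false i)))
                 (regroup (val (f (false , i))) (val (f (false , prev i))) (val (f (false , next i))) (val (f (true , i)))))
    where
    regroup : ∀ a p q r → r ℤ.+ (a ℤ.+ (p ℤ.+ q) ℤ.+ + 0) ≡ a ℤ.+ (p ℤ.+ (q ℤ.+ r))
    regroup = solve-∀

  column : (PVertex m → Label) → Fin m → Column
  column f i = f (false , i) , f (true , i)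

  weight-columns : ∀ f → weight m f ≡ ∑[ i < m ] colSum (column f i)
  weight-columns f = begin
    weight m f
      ≡⟨ sumℤ-allV m (val ∘ f) ⟩
    ∑[ i < m ] val (f (true , i)) ℤ.+ (∑[ i < m ] val (f (false , i)) ℤ.+ + 0)
      ≡⟨ cong (ℤ._+_ (∑[ i < m ] val (f (true , i)))) (ℤ.+-identityʳ _) ⟩
    ∑[ i < m ] val (f (true , i)) ℤ.+ ∑[ i < m ] val (f (false , i))
      ≡⟨ ℤ.+-comm (∑[ i < m ] val (f (true , i))) (∑[ i < m ] val (f (false , i))) ⟩
    ∑[ i < m ] val (f (false , i)) ℤ.+ ∑[ i < m ] val (f (true , i))
      ≡⟨ ∑-distrib-+ (λ i → val (f (false , i))) (λ i → val (f (true , i))) ⟨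
    ∑[ i < m ] colSum (column f i) ∎
    where open ≡-Reasoning

  module _ (f : PVertex m → Label) where

    LocalAt : Bool → Fin m → Set
    LocalAt b i = LocalCondition (f (b , i)) (f (b , prev i)) (f (b , next i)) (f (not b , i))

    neighbour : ∀ {P : Label → Set} b i {w} → Adj m (b , i) w → P (f w) →
                P (f (b , prev i)) ⊎ P (f (b , next i)) ⊎ P (f (not b , i))
    neighbour b i adj Pw with adj-cases b i adj
    ... | inj₁ refl        = inj₁ Pw
    ... | inj₂ (inj₁ refl) = inj₂ (inj₁ Pw)
    ... | inj₂ (inj₂ refl) = inj₂ (inj₂ Pw)

    twoNeighbours : ∀ b i {w w′} → w ≢ w′ → Adj m (b , i) w → Adj m (b , i) w′ → f w ≡ two → f w′ ≡ two →
      let p = f (b , prev i) ; q = f (b , next i) ; r = f (not b , i) in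
      p ≡ two × q ≡ two ⊎ p ≡ two × r ≡ two ⊎ q ≡ two × r ≡ two
    twoNeighbours b i w≢w′ adj adj′ fw fw′ with adj-cases b i adj | adj-cases b i adj′
    ... | inj₁ refl        | inj₁ refl        = ⊥-elim (w≢w′ refl)
    ... | inj₁ refl        | inj₂ (inj₁ refl) = inj₁ (fw , fw′)
    ... | inj₁ refl        | inj₂ (inj₂ refl) = inj₂ (inj₁ (fw , fw′))
    ... | inj₂ (inj₁ refl) | inj₁ refl        = inj₁ (fw′ , fw)
    ... | inj₂ (inj₁ refl) | inj₂ (inj₁ refl) = ⊥-elim (w≢w′ refl)
    ... | inj₂ (inj₁ refl) | inj₂ (inj₂ refl) = inj₂ (inj₂ (fw , fw′))
    ... | inj₂ (inj₂ refl) | inj₁ refl        = inj₂ (inj₁ (fw′ , fw))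
    ... | inj₂ (inj₂ refl) | inj₂ (inj₁ refl) = inj₂ (inj₂ (fw′ , fw))
    ... | inj₂ (inj₂ refl) | inj₂ (inj₂ refl) = ⊥-elim (w≢w′ refl)

    isSDRDF⇒local : IsSDRDF m f → ∀ b i → LocalAt b i
    isSDRDF⇒local sdr b i = minusOne , one′ , closedSum
      where
      open IsSDRDF sdr
      minusOne : f (b , i) ≡ m1 → MinusOneCondition (f (b , prev i)) (f (b , next i)) (f (not b , i))
      minusOne fu≡m1 with cond-1 (b , i) fu≡m1
      ... | inj₁ (w , adj , fw≡3)                      = inj₁ (neighbour {_≡ three} b i adj fw≡3)
      ... | inj₂ (w , w′ , w≢w′ , adj , adj′ , fw , fw′) = inj₂ (twoNeighbours b i w≢w′ adj adj′ fw fw′)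
      one′ : f (b , i) ≡ one → OneCondition (f (b , prev i)) (f (b , next i)) (f (not b , i))
      one′ fu≡1 = let (w , adj , big) = cond1 (b , i) fu≡1 in neighbour {TwoOrThree} b i adj big
      closedSum : + 1 ℤ.≤ val (f (b , i)) ℤ.+ (val (f (b , prev i)) ℤ.+ (val (f (b , next i)) ℤ.+ val (f (not b , i))))
      closedSum = subst (+ 1 ℤ.≤_) (closedNbhdSum-local f b i) (cond3 (b , i))

    private
      neighbourWith : ∀ {P : Label → Set} b i →
        P (f (b , prev i)) ⊎ P (f (b , next i)) ⊎ P (f (not b , i)) → ∃[ w ] (Adj m (b , i) w × P (f w))
      neighbourWith b i (inj₁ P-prev)          = (b , prev i) , adj-prev b i , P-prev
      neighbourWith b i (inj₂ (inj₁ P-next))   = (b , next i) , adj-next b i , P-next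
      neighbourWith b i (inj₂ (inj₂ P-across)) = (not b , i) , adj-across b i , P-across

      across≢ : ∀ b i j → _≢_ {A = PVertex m} (b , j) (not b , i)
      across≢ b i j eq = Bool.not-¬ refl (cong proj₁ eq)

    local⇒isSDRDF : (∀ b i → LocalAt b i) → IsSDRDF m f
    local⇒isSDRDF local = record { cond-1 = minusOne ; cond1 = one′ ; cond3 = closedSum }
      where
      minusOne : ∀ u → f u ≡ m1 →
        (∃[ w ] (Adj m u w × f w ≡ three)) ⊎
        (∃[ w ] ∃[ w′ ] (w ≢ w′ × Adj m u w × Adj m u w′ × f w ≡ two × f w′ ≡ two))
      minusOne (b , i) fu≡m1 with proj₁ (local b i) fu≡m1
      ... | inj₁ three-nearby = inj₁ (neighbourWith {_≡ three} b i three-nearby)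
      ... | inj₂ (inj₁ (fp , fq)) =
        inj₂ ((b , prev i) , (b , next i) , (λ eq → prev≢next i (cong proj₂ eq)) , adj-prev b i , adj-next b i , fp , fq)
      ... | inj₂ (inj₂ (inj₁ (fp , fr))) =
        inj₂ ((b , prev i) , (not b , i) , across≢ b i (prev i) , adj-prev b i , adj-across b i , fp , fr)
      ... | inj₂ (inj₂ (inj₂ (fq , fr))) =
        inj₂ ((b , next i) , (not b , i) , across≢ b i (next i) , adj-next b i , adj-across b i , fq , fr)
      one′ : ∀ u → f u ≡ one → ∃[ w ] (Adj m u w × (f w ≡ two ⊎ f w ≡ three))
      one′ (b , i) fu≡1 = neighbourWith {TwoOrThree} b i (proj₁ (proj₂ (local b i)) fu≡1)
      closedSum : ∀ u → + 1 ℤ.≤ closedNbhdSum m f u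
      closedSum (b , i) = subst (+ 1 ℤ.≤_) (sym (closedNbhdSum-local f b i)) (proj₂ (proj₂ (local b i)))

  isSDRDF⇔windows : ∀ f → IsSDRDF m f ⇔ (∀ i → ValidTriple (column f (prev i)) (column f i) (column f (next i)))
  isSDRDF⇔windows f = mk⇔
    (λ sdr i → isSDRDF⇒local f sdr false i , isSDRDF⇒local f sdr true i)
    (λ windows → local⇒isSDRDF f λ { false i → proj₁ (windows i) ; true i → proj₂ (windows i) })

  index : ℕ → Fin m
  index zero    = zero
  index (suc k) = next (index k)

  toℕ-index : ∀ k → k < m → toℕ (index k) ≡ k
  toℕ-index zero    _   = refl
  toℕ-index (suc k) k<m = trans (toℕ-next-< (index k) (subst (λ j → suc j < m) (sym ih) k<m)) (cong suc ih)
    where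
    ih : toℕ (index k) ≡ k
    ih = toℕ-index k (ℕ.<-trans (ℕ.n<1+n k) k<m)

  index-toℕ : ∀ i → index (toℕ i) ≡ i
  index-toℕ i = Fin.toℕ-injective (toℕ-index (toℕ i) (Fin.toℕ<n i))

  index-m : index m ≡ zero
  index-m = Fin.toℕ-injective (toℕ-next-wraps (index (2 + n)) (cong suc (toℕ-index (2 + n) (ℕ.n<1+n _))))

  weight-lowerBound : ∀ f → IsSDRDF m f → + (m + excess (0₄ +₄ m)) ℤ.≤ weight m f
  weight-lowerBound f sdr = subst (+ (m + e) ℤ.≤_) (sym weight≡) (+-cancelʳ-≤ (+ (m + e)) total initial (begin
    + m ℤ.+ + e ℤ.+ initial                 ≡⟨ swap (+ m) (+ e) initial ⟩
    + e ℤ.+ initial ℤ.+ + m                 ≤⟨ ℤ.+-monoˡ-≤ (+ m) (potential-endpoint (t 0) (t 1) r) ⟩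
    potential c r (t 0) (t 1) ℤ.+ + m       ≡⟨ cong (λ i → potential c r (column f i) (column f (next i)) ℤ.+ + m) index-m ⟨
    potential c r (t m) (t (suc m)) ℤ.+ + m ≤⟨ telescope m t 0₄ valid ⟩
    total ℤ.+ initial                       ∎))
    where
    t : ℕ → Column
    t k = column f (index k)
    c : Class
    c = startClass (t 0) (t 1)
    open Telescoping ValidTriple colSum (potential c) (λ v → potential-decreasing v c)
    open ℤ.≤-Reasoning
    r : ℤ₄
    r = 0₄ +₄ m
    e : ℕ
    e = excess r
    initial total : ℤ
    initial = potential c 0₄ (t 0) (t 1)
    total = ∑[ k < m ] colSum (t (toℕ k))
    valid : ∀ k → ValidTriple (t k) (t (suc k)) (t (suc (suc k)))
    valid k = subst (λ i → ValidTriple (column f i) (t (suc k)) (t (suc (suc k)))) (prev-next (index k))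
                (Equivalence.to (isSDRDF⇔windows f) sdr (index (suc k)))
    weight≡ : weight m f ≡ total
    weight≡ = trans (weight-columns f) (sum-cong-≗ λ i → cong (colSum ∘ column f) (sym (index-toℕ i)))
    swap : ∀ x y z → x ℤ.+ y ℤ.+ z ≡ y ℤ.+ z ℤ.+ x
    swap = solve-∀

  fromColumns : (ℕ → Column) → PVertex m → Label
  fromColumns g (false , i) = proj₁ (g (toℕ i))
  fromColumns g (true  , i) = proj₂ (g (toℕ i))

  fromColumns-isSDRDF : ∀ g → (∀ k → Window g k) →
    ValidTriple (g (1 + n)) (g (2 + n)) (g 0) → ValidTriple (g (2 + n)) (g 0) (g 1) →
    IsSDRDF m (fromColumns g)
  fromColumns-isSDRDF g windows seam₁ seam₂ = Equivalence.from (isSDRDF⇔windows (fromColumns g)) windowAt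
    where
    window-cong : ∀ {a a′ b b′ c c′} → a ≡ a′ → b ≡ b′ → c ≡ c′ →
      ValidTriple (g a′) (g b′) (g c′) → ValidTriple (g a) (g b) (g c)
    window-cong refl refl refl v = v
    windowAt : ∀ i → ValidTriple (g (toℕ (prev i))) (g (toℕ i)) (g (toℕ (next i)))
    windowAt zero = window-cong (toℕ-prev zero) refl (toℕ-next-< zero (s≤s (s≤s z≤n))) seam₂
    windowAt (suc j) with wraps? (suc j)
    ... | inj₁ j+2<m = window-cong (toℕ-prev (suc j)) refl (toℕ-next-< (suc j) j+2<m) (windows (toℕ j))
    ... | inj₂ wraps = window-cong (trans (toℕ-prev (suc j)) j≡n+1) (cong suc j≡n+1) (toℕ-next-wraps (suc j) wraps) seam₁
      where
      j≡n+1 : toℕ j ≡ 1 + n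
      j≡n+1 = ℕ.suc-injective (ℕ.suc-injective wraps)

-- Labellings built from a prefix followed by a period-4 tail

prefixThen : ∀ {p} → Vec Column p → (ℤ₄ → Column) → ℕ → Column
prefixThen []      T k       = T (0₄ +₄ k)
prefixThen (x ∷ P) T zero    = x
prefixThen (x ∷ P) T (suc k) = prefixThen P T k

prefixThen-tail : ∀ {p} (P : Vec Column p) T k → prefixThen P T (p + k) ≡ T (0₄ +₄ k)
prefixThen-tail []      T k = refl
prefixThen-tail (x ∷ P) T k = prefixThen-tail P T k

PeriodicWindows : (ℤ₄ → Column) → Set
PeriodicWindows T = ∀ r → ValidTriple (T r) (T (suc₄ r)) (T (suc₄ (suc₄ r)))

prefixThen-windows : ∀ {p} (P : Vec Column p) T → PeriodicWindows T →
  (∀ (k : Fin p) → Window (prefixThen P T) (toℕ k)) → ∀ k → Window (prefixThen P T) k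
prefixThen-windows []      T periodic _      k
  rewrite +₄-suc 0₄ k | +₄-suc 0₄ (suc k) | +₄-suc 0₄ k = periodic (0₄ +₄ k)
prefixThen-windows (x ∷ P) T periodic prefix zero    = prefix zero
prefixThen-windows (x ∷ P) T periodic prefix (suc k) = prefixThen-windows P T periodic (prefix ∘ suc) k

BlockWeight4 : (ℤ₄ → Column) → Set
BlockWeight4 T = ∀ r → colSum (T r) ℤ.+ (colSum (T (suc₄ r)) ℤ.+ (colSum (T (suc₄ (suc₄ r))) ℤ.+ colSum (T (suc₄ (suc₄ (suc₄ r)))))) ≡ + 4

∑-period : ∀ T → BlockWeight4 T → ∀ q r → ∑[ k < q * 4 ] colSum (T (r +₄ toℕ k)) ≡ + (q * 4)
∑-period T block zero    r = refl
∑-period T block (suc q) r =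
  trans (regroup (colSum (T r)) (colSum (T (suc₄ r))) (colSum (T (suc₄ (suc₄ r)))) (colSum (T (suc₄ (suc₄ (suc₄ r))))) _)
        (cong₂ ℤ._+_ (block r) (∑-period T block q (suc₄ (suc₄ (suc₄ (suc₄ r))))))
  where
  regroup : ∀ a b c d s → a ℤ.+ (b ℤ.+ (c ℤ.+ (d ℤ.+ s))) ≡ a ℤ.+ (b ℤ.+ (c ℤ.+ d)) ℤ.+ s
  regroup = solve-∀

-- The cycle of length 3 + p + 4q labelled by the first 1 + p columns, then q full periods
-- and finally T 0₄, T 1₄; these last two are what the seam conditions refer to.
record Admissible {p} (P : Vec Column (suc p)) (T : ℤ₄ → Column) : Set where
  field
    periodic : PeriodicWindows T
    block    : BlockWeight4 T
    prefix   : ∀ (k : Fin (suc p)) → Window (prefixThen P T) (toℕ k)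
    seam₁    : ValidTriple (T 0₄) (T 1₄) (prefixThen P T 0)
    seam₂    : ValidTriple (T 1₄) (prefixThen P T 0) (prefixThen P T 1)
    baseWeight : ∑[ k < 3 + p ] colSum (prefixThen P T (toℕ k)) ≡ + (3 + p + excess (0₄ +₄ (3 + p)))

admissible? : ∀ {p} (P : Vec Column (suc p)) T → Dec (Admissible P T)
admissible? P T = map′
  (λ { (a , b , c , d , e , f) → record { periodic = a ; block = b ; prefix = c ; seam₁ = d ; seam₂ = e ; baseWeight = f } })
  (λ A → let open Admissible A in periodic , block , prefix , seam₁ , seam₂ , baseWeight)
  (∀-ℤ₄? (λ r → validTriple? (T r) (T (suc₄ r)) (T (suc₄ (suc₄ r)))) ×-dec
   ∀-ℤ₄? (λ r → colSum (T r) ℤ.+ (colSum (T (suc₄ r)) ℤ.+ (colSum (T (suc₄ (suc₄ r))) ℤ.+ colSum (T (suc₄ (suc₄ (suc₄ r)))))) ℤ.≟ + 4) ×-dec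
   Fin.all? (λ k → validTriple? (s (toℕ k)) (s (suc (toℕ k))) (s (suc (suc (toℕ k))))) ×-dec
   validTriple? (T 0₄) (T 1₄) (s 0) ×-dec validTriple? (T 1₄) (s 0) (s 1) ×-dec
   _ ℤ.≟ _)
  where
  s : ℕ → Column
  s = prefixThen P T

module _ {p} (P : Vec Column (suc p)) (T : ℤ₄ → Column) (admissible : Admissible P T) (q : ℕ) where

  open Cycle (p + q * 4)

  open Admissible admissible

  private
    s : ℕ → Column
    s = prefixThen P T

    s-tail : ∀ k → s (3 + p + k) ≡ T (2₄ +₄ k)
    s-tail k = trans (cong s (cong suc (sym (trans (ℕ.+-suc p (suc k)) (cong suc (ℕ.+-suc p k))))))
                     (prefixThen-tail P T (2 + k))

    s-seam₁ : s (1 + (p + q * 4)) ≡ T 0₄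
    s-seam₁ = trans (prefixThen-tail P T (q * 4)) (cong T (+₄-*4 0₄ q))

    s-seam₂ : s (2 + (p + q * 4)) ≡ T 1₄
    s-seam₂ = trans (cong s (cong suc (sym (ℕ.+-suc p (q * 4))))) (trans (prefixThen-tail P T (suc (q * 4))) (cong T (+₄-*4 1₄ q)))

    weight≡ : ∑[ k < m ] colSum (s (toℕ k)) ≡ + (m + excess (0₄ +₄ m))
    weight≡ = begin
      ∑[ k < 3 + p + q * 4 ] colSum (s (toℕ k))
        ≡⟨ ∑-split (3 + p) (q * 4) (colSum ∘ s) ⟩
      ∑[ k < 3 + p ] colSum (s (toℕ k)) ℤ.+ ∑[ k < q * 4 ] colSum (s (3 + p + toℕ k))
        ≡⟨ cong₂ ℤ._+_ baseWeight (trans (sum-cong-≗ {q * 4} (λ k → cong colSum (s-tail (toℕ k)))) (∑-period T block q 2₄)) ⟩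
      + (3 + p + excess (0₄ +₄ (3 + p)) + q * 4)
        ≡⟨ cong +_ (arith (3 + p) (excess (0₄ +₄ (3 + p))) (q * 4)) ⟩
      + (m + excess (0₄ +₄ (3 + p)))
        ≡⟨ cong (λ r → + (m + excess r)) (trans (sym (+₄-*4 (0₄ +₄ (3 + p)) q)) (sym (+₄-+ 0₄ (3 + p) (q * 4)))) ⟩
      + (m + excess (0₄ +₄ m)) ∎
      where
      open ≡-Reasoning
      arith : ∀ a b c → a + b + c ≡ a + c + b
      arith a b c = trans (ℕ.+-assoc a b c) (trans (cong (_+_ a) (ℕ.+-comm b c)) (sym (ℕ.+-assoc a c b)))

  pattern-realises : ∃[ f ] (IsSDRDF m f × weight m f ≡ + (m + excess (0₄ +₄ m)))
  pattern-realises =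
    fromColumns s ,
    fromColumns-isSDRDF s (prefixThen-windows P T periodic prefix)
      (subst₂ (λ x y → ValidTriple x y (s 0)) (sym s-seam₁) (sym s-seam₂) seam₁)
      (subst (λ y → ValidTriple y (s 0) (s 1)) (sym s-seam₂) seam₂) ,
    trans (weight-columns (fromColumns s)) weight≡

-- Extremal labellings and the value of γ_sdR(P_{m,1})

negative positive rising falling : Column
negative = m1  , m1
positive = two , two
rising   = m1  , two
falling  = two , m1

alternating : ℤ₄ → Column
alternating 0₄ = negative
alternating 1₄ = positive
alternating 2₄ = negative
alternating 3₄ = positive

zigzag : ℤ₄ → Column
zigzag 0₄ = rising
zigzag 1₄ = falling
zigzag 2₄ = falling
zigzag 3₄ = rising

-- The pattern for the cycle length m = 3 + e + 4q.
patternPrefix : (e : Fin 4) → Vec Column (suc (toℕ e))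
patternPrefix 0F = (one , one) ∷ []
patternPrefix 1F = negative ∷ positive ∷ []
patternPrefix 2F = (m1 , one) ∷ falling ∷ positive ∷ []
patternPrefix 3F = negative ∷ positive ∷ negative ∷ positive ∷ []

patternPeriod : Fin 4 → ℤ₄ → Column
patternPeriod 0F = zigzag
patternPeriod _  = alternating

patterns-admissible : ∀ e → Admissible (patternPrefix e) (patternPeriod e)
patterns-admissible = from-yes (Fin.all? λ e → admissible? (patternPrefix e) (patternPeriod e))

weight-upperBound : ∀ n → ∃[ f ] (IsSDRDF (3 + n) f × weight (3 + n) f ≡ + (3 + n + excess (0₄ +₄ (3 + n))))
weight-upperBound n with n divMod 4
... | result q e refl = pattern-realises (patternPrefix e) (patternPeriod e) (patterns-admissible e) q

γsdR-prism : ∀ n → γsdR≡ (3 + n) (+ (3 + n + excess (0₄ +₄ (3 + n))))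
γsdR-prism n = weight-upperBound n , Cycle.weight-lowerBound n

excess-even : ∀ m → m % 2 ≡ 0 → excess (0₄ +₄ m) ≡ 0
excess-even m m%2≡0 = trans (cong excess (+₄-%4 0₄ m)) (byResidue (m % 4) (m%n<n m 4) (trans (m∣n⇒o%n%m≡o%m 2 4 m (divides 2 refl)) m%2≡0))
  where
  byResidue : ∀ r → r < 4 → r % 2 ≡ 0 → excess (0₄ +₄ r) ≡ 0
  byResidue 0 _ _ = refl
  byResidue 2 _ _ = refl
  byResidue 1 _ ()
  byResidue 3 _ ()
  byResidue (suc (suc (suc (suc _)))) (s≤s (s≤s (s≤s (s≤s ())))) _

excess-mod4 : ∀ m {r} → m % 4 ≡ r → excess (0₄ +₄ m) ≡ excess (0₄ +₄ r)
excess-mod4 m m%4≡r = cong excess (trans (+₄-%4 0₄ m) (cong (0₄ +₄_) m%4≡r))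

theorem6 : (m : ℕ) → 3 ≤ m →
    ((m % 2 ≡ 0 → γsdR≡ m (+ m)) ×
     (m % 4 ≡ 3 → γsdR≡ m (+ (m + 1))) ×
     (m % 4 ≡ 1 → γsdR≡ m (+ (m + 2))))
theorem6 (suc (suc (suc n))) (s≤s (s≤s (s≤s z≤n))) =
  (λ even → valueIs (trans (cong (_+_ m) (excess-even m even)) (ℕ.+-identityʳ m))) ,
  (λ m≡3 → valueIs (cong (_+_ m) (excess-mod4 m m≡3))) ,
  (λ m≡1 → valueIs (cong (_+_ m) (excess-mod4 m m≡1)))
  where
  m : ℕ
  m = 3 + n
  valueIs : ∀ {k} → m + excess (0₄ +₄ m) ≡ k → γsdR≡ m (+ k)
  valueIs eq = subst (λ k → γsdR≡ m (+ k)) eq (γsdR-prism n)
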